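{- The clique number of the 1-skeleton of $\mathrm{PYR}(n)$ satisfies $\omega(\mathrm{PYR}(n))=\Theta(n^{2})$ as $n\to\infty$.
   Context: Let $K_n$ be the complete undirected graph on vertex set $\{1,\dots,n\}$ with edge set $E$. A Hamiltonian tour $\langle 1,i_1,\dots,i_r,n,j_1,\dots,j_{n-r-2}\rangle$ is called pyramidal if $i_1<\dots<i_r$ and $j_1>\dots>j_{n-r-2}$ (tours are undirected). The characteristic vector $x^{v}\in\mathbb{R}^{E}$ of a tour $x$ has $x^{v}_e=1$ iff $e$ is an edge of $x$. $\mathrm{PYR}(n)=\mathrm{conv}\{x^{v} : x$ pyramidal tour in $K_n\}$. The 1-skeleton of a polytope is the graph whose vertices are the vertices of the polytope and whose edges are the one-dimensional faces of the polytope; $\omega(\mathrm{PYR}(n))$ denotes the maximum number of vertices of a clique in the 1-skeleton of $\mathrm{PYR}(n)$. -}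

module Defs where

open import Data.Bool using (Bool; true; false; if_then_else_; _∨_; _∧_)
open import Data.Nat using (ℕ; zero; suc; _<_; _≡ᵇ_)
open import Data.Nat.Properties using (_<?_)
open import Data.Product using (_×_; _,_; ∃-syntax; proj₁; proj₂)
open import Data.List using (List; []; _∷_; _++_; [_]; map; upTo; zip; filter; cartesianProduct; foldr)
open import Data.Bool.ListAction using (any)
open import Data.List.Membership.Propositional using (_∈_)
open import Data.List.Relation.Unary.Linked using (Linked)
open import Data.List.Relation.Binary.Permutation.Propositional using (_↭_)
open import Data.Rational using (ℚ; 0ℚ; _+_)
open import Relation.Binary.PropositionalEquality using (_≡_)
open import Relation.Nullary using (¬_)
open import Function using (flip)

vertices : ℕ → List ℕ
vertices n = map suc (upTo n)

-- The edge set E of K_n: unordered pairs {i,j}, represented as (i , j) with i < j.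
edgesK : ℕ → List (ℕ × ℕ)
edgesK n = filter (λ p → proj₁ p <? proj₂ p) (cartesianProduct (vertices n) (vertices n))

-- A (pyramidal) tour is written as the cyclic sequence
-- ⟨1, i₁, …, i_r, n, j₁, …, j_{n-r-2}⟩ of all vertices, each exactly once.
IsPyramidalTour : ℕ → List ℕ → Set
IsPyramidalTour n t =
  ∃[ is ] ∃[ js ]
    ( t ≡ 1 ∷ is ++ n ∷ js
    × Linked _<_ is
    × Linked (flip _<_) js
    × t ↭ vertices n )

cyclicPairs : List ℕ → List (ℕ × ℕ)
cyclicPairs [] = []
cyclicPairs (x ∷ xs) = zip (x ∷ xs) (xs ++ [ x ])

-- Characteristic vector x^v ∈ {0,1}^E of the tour t: entry at edge {i,j}
-- is true iff {i,j} is an (undirected) edge of the tour.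
charVec : List ℕ → ℕ × ℕ → Bool
charVec t (i , j) =
  any (λ p → ((proj₁ p ≡ᵇ i) ∧ (proj₂ p ≡ᵇ j)) ∨ ((proj₁ p ≡ᵇ j) ∧ (proj₂ p ≡ᵇ i)))
      (cyclicPairs t)

-- Equality of characteristic vectors as points of ℝ^E (coordinatewise on E).
SameVec : ℕ → List ℕ → List ℕ → Set
SameVec n t s = ∀ e → e ∈ edgesK n → charVec t e ≡ charVec s e

eval : ℕ → (ℕ × ℕ → ℚ) → List ℕ → ℚ
eval n c t = foldr (λ e acc → (if charVec t e then c e else 0ℚ) + acc) 0ℚ (edgesK n)

-- The vertices x^v(t), x^v(s) of PYR(n) are adjacent in the 1-skeleton iff they are
-- distinct and conv{x^v(t), x^v(s)} is a (1-dimensional) face of PYR(n), i.e. there is a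
-- linear functional c maximised over PYR(n) exactly on that segment: c takes the same
-- value at both and a strictly smaller value at every other vertex of PYR(n).
Adjacent : ℕ → List ℕ → List ℕ → Set
Adjacent n t s =
  ¬ SameVec n t s ×
  ∃[ c ] ( eval n c t ≡ eval n c s
         × (∀ u → IsPyramidalTour n u → ¬ SameVec n u t → ¬ SameVec n u s →
               Data.Rational._<_ (eval n c u) (eval n c t)) )

{-# OPTIONS --safe #-}
module Submission where

-- A pyramidal tour is the union of an ascending chain 1 → n and a descending chain n → 1, and it is
-- determined by its switches: the vertices 2 < k < n such that k - 1 and k lie on different chains, which
-- are exactly those for which {k - 1, k} is not an edge.
--
-- Suppose two tours t, t′ share a switch x while their switch sets differ both below and
-- above x. Splicing them at x in both orders yields two further tours whose characteristic vectors add up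
-- to x^t + x^t′, so no linear functional is maximised over PYR(n) exactly at t and t′: they are not
-- adjacent. In a family of switch sets without such crossings, a member is determined by its last branch
-- point (a switch at which another member agreeing with it so far branches off) together with its last
-- switch before that point, so a clique has at most (n + 1)² vertices.
--
-- The tours with exactly two switches a < m ≤ b are pairwise adjacent: for two of them, the
-- functional that vanishes on their edges and is -1 elsewhere is maximised exactly at them, because the
-- long edges of any other tour, followed from vertex 1 on, eventually leave both. Taking m ≈ n / 2 gives
-- about n² / 16 such tours.

open import Defs
open import Data.Nat using (ℕ; _≤_; _*_; _^_)
open import Data.Product using (_×_; ∃-syntax)
open import Data.List using (List; length)
open import Data.List.Relation.Unary.All using (All)
open import Data.List.Relation.Unary.AllPairs using (AllPairs)

open import Algebra.Bundles using (CommutativeMonoid)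
open import Data.Bool using (Bool; true; false; not; _∧_; _∨_; _xor_; if_then_else_)
import Data.Bool as Bool
open import Data.Bool.ListAction using (any)
open import Data.Bool.Properties
  using (T-≡; not-injective; not-involutive; not-¬; ¬-not; ∧-zeroʳ; ∨-zeroʳ; xor-same; xor-assoc; xor-inverseˡ; xor-inverseʳ)
open import Data.Empty using (⊥; ⊥-elim)
open import Data.List
  using ([]; _∷_; _++_; [_]; _∷ʳ_; zip; map; foldr; filter; applyUpTo; applyDownFrom; cartesianProduct)
open import Data.List.Membership.Propositional using (_∈_; _∉_; find; lose)
open import Data.List.Membership.Propositional.Properties
  using ( ∈-++⁺ˡ; ∈-++⁺ʳ; ∈-++⁻; ∈-map⁺; ∈-map⁻; ∈-upTo⁺; ∈-upTo⁻; ∈-applyUpTo⁺; ∈-applyUpTo⁻; ∈-filter⁺; ∈-filter⁻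
        ; ∈-cartesianProduct⁺; ∈-cartesianProduct⁻)
open import Data.List.Properties
  using ( filter-all; filter-accept; filter-reject; length-map; length-++; length-applyUpTo; ++-assoc
        ; applyUpTo-∷ʳ; map-upTo; reverse-applyUpTo; partition-defn)
open import Data.List.Relation.Binary.Permutation.Propositional
  using (_↭_; prep; ↭-sym; ↭⇒↭ₛ; ↭ₛ⇒↭; module PermutationReasoning)
open import Data.List.Relation.Binary.Permutation.Propositional.Properties
  using (∈-resp-↭; shift; ∷↭∷ʳ; ++⁺ˡ; ++⁺ʳ; filter-↭; ↭-reverse)
open import Data.List.Relation.Unary.All using ([]; _∷_)
import Data.List.Relation.Unary.All as All
import Data.List.Relation.Unary.All.Properties as AllP
open import Data.List.Relation.Unary.AllPairs using ([]; _∷_)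
import Data.List.Relation.Unary.AllPairs as AllPairs
import Data.List.Relation.Unary.AllPairs.Properties as AllPairs
open import Data.List.Relation.Unary.Any using (here; there)
open import Data.List.Relation.Unary.Any.Properties using (any⁺; any⁻)
open import Data.List.Relation.Unary.Linked using (Linked)
open import Data.List.Relation.Unary.Linked.Properties using (Linked⇒AllPairs; AllPairs⇒Linked)
import Data.List.Relation.Unary.Unique.Propositional.Properties as Unique
open import Data.Nat
  using (>-nonZero; zero; suc; pred; _+_; _∸_; _<_; _≮_; _≡ᵇ_; _<ᵇ_; _≤ᵇ_; z≤n; s≤s; _≟_; _<?_; _≤?_)
open import Data.Nat.Properties
open import Data.Product using (_,_; proj₁; proj₂)
import Data.Product as Product
import Data.Rational as ℚ
import Data.Rational.Properties as ℚ
open import Data.Sum using (_⊎_; inj₁; inj₂)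
import Data.Sum as Sum
open import Function using (_∘_; flip; Equivalence)
open import Relation.Binary.Definitions using (Transitive; tri<; tri≈; tri>)
open import Relation.Binary.PropositionalEquality hiding ([_])
open import Relation.Nullary using (¬_; Dec; yes; no; does; proof; contradiction)
open import Relation.Nullary.Decidable using (map′; ¬?; _×-dec_; _⊎-dec_; _→-dec_)
open import Relation.Nullary.Reflects using (Reflects; ofʸ; ofⁿ; fromEquivalence; det; _×-reflects_; _⊎-reflects_)
import Relation.Unary as U
open import Data.List.Membership.DecPropositional _≟_ using (_∈?_)
open import Data.List.Relation.Binary.Permutation.Setoid.Properties (setoid ℕ) using (Unique-resp-↭; partition-↭)

module _ {P : Set} where

  true⇒ : ∀ {b} → Reflects P b → b ≡ true → P
  true⇒ (ofʸ p) refl = p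

  ⇒true : ∀ {b} → Reflects P b → P → b ≡ true
  ⇒true (ofʸ _) _ = refl
  ⇒true (ofⁿ ¬p) p = contradiction p ¬p

  false⇒ : ∀ {b} → Reflects P b → b ≡ false → ¬ P
  false⇒ (ofⁿ ¬p) refl = ¬p

  ⇒false : ∀ {b} → Reflects P b → ¬ P → b ≡ false
  ⇒false (ofʸ p) ¬p = contradiction p ¬p
  ⇒false (ofⁿ _) _ = refl

  reflects : ∀ {b} → (b ≡ true → P) → (P → b ≡ true) → Reflects P b
  reflects sound complete = fromEquivalence (sound ∘ Equivalence.to T-≡) (Equivalence.from T-≡ ∘ complete)

≡true⇒≢false : ∀ {b} → b ≡ true → b ≢ false
≡true⇒≢false refl ()

≡-from-≡true : ∀ {b c} → (b ≡ true → c ≡ true) → (c ≡ true → b ≡ true) → b ≡ c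
≡-from-≡true {true} {true} _ _ = refl
≡-from-≡true {true} {false} f _ = sym (f refl)
≡-from-≡true {false} {true} _ g = g refl
≡-from-≡true {false} {false} _ _ = refl

xor-reflects-≢ : ∀ a b → Reflects (a ≢ b) (a xor b)
xor-reflects-≢ true true = ofⁿ (λ ne → ne refl)
xor-reflects-≢ true false = ofʸ λ ()
xor-reflects-≢ false true = ofʸ λ ()
xor-reflects-≢ false false = ofⁿ (λ ne → ne refl)

not-reflects-≡false : ∀ b → Reflects (b ≡ false) (not b)
not-reflects-≡false true = ofⁿ λ ()
not-reflects-≡false false = ofʸ refl

xor-involutiveˡ : ∀ a b → (a xor (a xor b)) ≡ b
xor-involutiveˡ a b = trans (sym (xor-assoc a a b)) (cong (_xor b) (xor-same a))

xor-cancelʳ : ∀ a b f → ((a xor f) xor (b xor f)) ≡ (a xor b)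
xor-cancelʳ true true f = xor-same (not f)
xor-cancelʳ true false f = xor-inverseˡ f
xor-cancelʳ false true f = xor-inverseʳ f
xor-cancelʳ false false f = xor-same f

≡ᵇ-reflects-≡ : ∀ m n → Reflects (m ≡ n) (m ≡ᵇ n)
≡ᵇ-reflects-≡ m n = fromEquivalence (≡ᵇ⇒≡ m n) (≡⇒≡ᵇ m n)

<ᵇ-true : ∀ {m n} → m < n → (m <ᵇ n) ≡ true
<ᵇ-true = ⇒true (<ᵇ-reflects-< _ _)

<ᵇ-false : ∀ {m n} → m ≮ n → (m <ᵇ n) ≡ false
<ᵇ-false = ⇒false (<ᵇ-reflects-< _ _)

∧-cong-guarded : ∀ a b {c d} → (a ≡ true → b ≡ true → c ≡ d) → (a ∧ b ∧ c) ≡ (a ∧ b ∧ d)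
∧-cong-guarded true true c≡d = c≡d refl refl
∧-cong-guarded true false _ = refl
∧-cong-guarded false _ _ = refl

Reflects-map : ∀ {A B : Set} {b} → (A → B) → (B → A) → Reflects A b → Reflects B b
Reflects-map f _ (ofʸ a) = ofʸ (f a)
Reflects-map _ g (ofⁿ ¬a) = ofⁿ (¬a ∘ g)

module _ {A : Set} where

  consecutive : List A → List (A × A)
  consecutive (x ∷ y ∷ l) = (x , y) ∷ consecutive (y ∷ l)
  consecutive _ = []

  zip-consecutive : ∀ x xs y → zip (x ∷ xs) (xs ++ [ y ]) ≡ consecutive (x ∷ xs ++ [ y ])
  zip-consecutive x [] y = refl
  zip-consecutive x (x′ ∷ xs) y = cong ((x , x′) ∷_) (zip-consecutive x′ xs y)

  consecutive-++ : ∀ xs a ys → consecutive (xs ++ a ∷ ys) ≡ consecutive (xs ++ [ a ]) ++ consecutive (a ∷ ys)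
  consecutive-++ [] a ys = refl
  consecutive-++ (x ∷ []) a ys = refl
  consecutive-++ (x ∷ x′ ∷ xs) a ys = cong ((x , x′) ∷_) (consecutive-++ (x′ ∷ xs) a ys)

  module Sorted {R : A → A → Set} (R-trans : Transitive R) (R-irrefl : ∀ {x} → ¬ R x x) where

    ∈-consecutive⁻ : ∀ {C i j} → AllPairs R C → (i , j) ∈ consecutive C →
                     i ∈ C × j ∈ C × R i j × (∀ k → R i k → R k j → k ∉ C)
    ∈-consecutive⁻ {x ∷ y ∷ l} ((Rxy ∷ Rxl) ∷ Ryl ∷ _) (here refl) =
      here refl , there (here refl) , Rxy , nothing-between
      where
        nothing-between : ∀ k → R x k → R k y → k ∉ x ∷ y ∷ l
        nothing-between k Rxk Rky (here refl) = R-irrefl Rxk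
        nothing-between k Rxk Rky (there (here refl)) = R-irrefl Rky
        nothing-between k Rxk Rky (there (there k∈l)) = R-irrefl (R-trans (All.lookup Ryl k∈l) Rky)
    ∈-consecutive⁻ {x ∷ y ∷ l} (Rx ∷ sorted) (there p) with ∈-consecutive⁻ {y ∷ l} sorted p
    ... | i∈ , j∈ , Rij , between = there i∈ , there j∈ , Rij , nothing-between
      where
        nothing-between : ∀ k → R _ k → R k _ → k ∉ x ∷ y ∷ l
        nothing-between k Rik Rkj (here refl) = R-irrefl (R-trans Rik (All.lookup Rx i∈))
        nothing-between k Rik Rkj (there k∈) = between k Rik Rkj k∈

    ∈-consecutive⁺ : ∀ {C i j} → AllPairs R C → i ∈ C → j ∈ C → R i j →
                     (∀ k → R i k → R k j → k ∉ C) → (i , j) ∈ consecutive C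
    ∈-consecutive⁺ {x ∷ l} _ (here refl) (here refl) Rxx _ = contradiction Rxx R-irrefl
    ∈-consecutive⁺ {x ∷ y ∷ l} _ (here refl) (there (here refl)) _ _ = here refl
    ∈-consecutive⁺ {x ∷ y ∷ l} ((Rxy ∷ _) ∷ Ryl ∷ _) (here refl) (there (there j∈)) _ between =
      contradiction (there (here refl)) (between y Rxy (All.lookup Ryl j∈))
    ∈-consecutive⁺ {x ∷ y ∷ l} (Rx ∷ _) (there i∈) (here refl) Rix _ =
      contradiction (R-trans Rix (All.lookup Rx i∈)) R-irrefl
    ∈-consecutive⁺ {x ∷ y ∷ l} (_ ∷ sorted) (there i∈) (there j∈) Rij between =
      there (∈-consecutive⁺ sorted i∈ j∈ Rij (λ k Rik Rkj → between k Rik Rkj ∘ there))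

AllPairs-across : ∀ {A : Set} {R : A → A → Set} xs {ys} → AllPairs R (xs ++ ys) → ∀ {x y} → x ∈ xs → y ∈ ys → R x y
AllPairs-across (_ ∷ xs) (Rx ∷ _) (here refl) y∈ = All.lookup Rx (∈-++⁺ʳ xs y∈)
AllPairs-across (_ ∷ xs) (_ ∷ R-xs++ys) (there x∈) y∈ = AllPairs-across xs R-xs++ys x∈ y∈

AllPairs-++⁻ʳ : ∀ {A : Set} {R : A → A → Set} xs {ys} → AllPairs R (xs ++ ys) → AllPairs R ys
AllPairs-++⁻ʳ [] R-ys = R-ys
AllPairs-++⁻ʳ (_ ∷ xs) (_ ∷ R-xs++ys) = AllPairs-++⁻ʳ xs R-xs++ys

AllPairs-map-∈ : ∀ {A : Set} {R S : A → A → Set} {xs : List A} →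
                 (∀ {x y} → x ∈ xs → y ∈ xs → R x y → S x y) → AllPairs R xs → AllPairs S xs
AllPairs-map-∈ f [] = []
AllPairs-map-∈ f (Rx ∷ R-xs) = All.tabulate (λ y∈ → f (here refl) (there y∈) (All.lookup Rx y∈))
                             ∷ AllPairs-map-∈ (λ x∈ y∈ → f (there x∈) (there y∈)) R-xs

AllPairs-∈-cases : ∀ {A : Set} {R : A → A → Set} {xs : List A} → AllPairs R xs → ∀ {x y} → x ∈ xs → y ∈ xs →
                   x ≡ y ⊎ R x y ⊎ R y x
AllPairs-∈-cases (_ ∷ _) (here refl) (here refl) = inj₁ refl
AllPairs-∈-cases (Rx ∷ _) (here refl) (there y∈) = inj₂ (inj₁ (All.lookup Rx y∈))
AllPairs-∈-cases (Rx ∷ _) (there x∈) (here refl) = inj₂ (inj₂ (All.lookup Rx x∈))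
AllPairs-∈-cases (_ ∷ R-xs) (there x∈) (there y∈) = AllPairs-∈-cases R-xs x∈ y∈

any-true⇒ : ∀ {A : Set} (f : A → Bool) xs → any f xs ≡ true → ∃[ x ] (x ∈ xs × f x ≡ true)
any-true⇒ f xs e = Product.map₂ (Product.map₂ (Equivalence.to T-≡)) (find (any⁻ f xs (Equivalence.from T-≡ e)))

⇒any-true : ∀ {A : Set} (f : A → Bool) {xs x} → x ∈ xs → f x ≡ true → any f xs ≡ true
⇒any-true f x∈ fx = Equivalence.to T-≡ (any⁺ f (lose x∈ (Equivalence.from T-≡ fx)))

length-cartesianProduct : ∀ {A B : Set} (xs : List A) (ys : List B) → length (cartesianProduct xs ys) ≡ length xs * length ys
length-cartesianProduct [] ys = refl
length-cartesianProduct (x ∷ xs) ys =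
  trans (length-++ (map (x ,_) ys)) (cong₂ _+_ (length-map (x ,_) ys) (length-cartesianProduct xs ys))

length-distinct-bounded : ∀ m ks → AllPairs _≢_ ks → All (_< m) ks → length ks ≤ m
length-distinct-bounded zero [] _ _ = z≤n
length-distinct-bounded zero (k ∷ ks) _ (() ∷ _)
length-distinct-bounded (suc m) ks distinct bounded =
  ≤-trans (length-≤-suc-others ks distinct)
          (s≤s (length-distinct-bounded m (others ks) (AllPairs.filter⁺ (¬? ∘ (_≟ m)) distinct) (others-bounded ks bounded)))
  where
    others : List ℕ → List ℕ
    others = filter (¬? ∘ (_≟ m))

    length-≤-suc-others : ∀ ks → AllPairs _≢_ ks → length ks ≤ suc (length (others ks))
    length-≤-suc-others [] _ = z≤n
    length-≤-suc-others (k ∷ ks) (k∉ks ∷ distinct) with k ≟ m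
    ... | yes refl rewrite filter-reject (¬? ∘ (_≟ k)) {x = k} {xs = ks} (λ k≢k → k≢k refl) =
      s≤s (≤-reflexive (sym (cong length (filter-all (¬? ∘ (_≟ k)) (All.map (_∘ sym) k∉ks)))))
    ... | no k≢m rewrite filter-accept (¬? ∘ (_≟ m)) {x = k} {xs = ks} k≢m = s≤s (length-≤-suc-others ks distinct)

    others-bounded : ∀ ks → All (_< suc m) ks → All (_< m) (others ks)
    others-bounded [] _ = []
    others-bounded (k ∷ ks) (k≤m ∷ bounded) with k ≟ m
    ... | yes k≡m rewrite filter-reject (¬? ∘ (_≟ m)) {x = k} {xs = ks} (λ k≢m → k≢m k≡m) = others-bounded ks bounded
    ... | no k≢m rewrite filter-accept (¬? ∘ (_≟ m)) {x = k} {xs = ks} k≢m =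
      ≤∧≢⇒< (≤-pred k≤m) k≢m ∷ others-bounded ks bounded

pred< : ∀ {m k} → m < k → pred k < k
pred< {k = suc k} _ = ≤-refl

pred-between : ∀ {i j} → suc (suc i) ≤ j → i < pred j × pred j < j
pred-between {j = suc j} (s≤s 1+i≤j) = 1+i≤j , ≤-refl

*+<*+ : ∀ {N b b′ x x′} → x < N → b < b′ → b * N + x < b′ * N + x′
*+<*+ {N} {b} {b′} {x} {x′} x<N b<b′ = begin-strict
  b * N + x   <⟨ +-monoʳ-< (b * N) x<N ⟩
  b * N + N   ≡⟨ +-comm (b * N) N ⟩
  suc b * N   ≤⟨ *-monoˡ-≤ N b<b′ ⟩
  b′ * N      ≤⟨ m≤m+n (b′ * N) x′ ⟩
  b′ * N + x′ ∎
  where open ≤-Reasoning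

*+-injective : ∀ {N b b′ x x′} → x < N → x′ < N → b * N + x ≡ b′ * N + x′ → b ≡ b′ × x ≡ x′
*+-injective {N} {b} {b′} {x} {x′} x<N x′<N e with <-cmp b b′
... | tri< b<b′ _ _ = contradiction e (<⇒≢ (*+<*+ x<N b<b′))
... | tri≈ _ refl _ = refl , +-cancelˡ-≡ (b * N) x x′ e
... | tri> _ _ b′<b = contradiction (sym e) (<⇒≢ (*+<*+ x′<N b′<b))

^2≡* : ∀ x → x ^ 2 ≡ x * x
^2≡* x = cong (x *_) (*-identityʳ x)

square-≤ : ∀ {m} k n → m ≤ k * n → m * m ≤ (k * k) * (n * n)
square-≤ k n m≤kn = ≤-trans (*-mono-≤ m≤kn m≤kn) (≤-reflexive ([m*n]*[o*p]≡[m*o]*[n*p] k n k n))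

None : (ℕ → Bool) → ℕ → ℕ → Set
None w lo hi = ∀ k → lo ≤ k → k < hi → w k ≡ false

None? : ∀ w lo hi → Dec (None w lo hi)
None? w lo hi = map′ (λ h k lo≤k k<hi → h k<hi lo≤k) (λ h {k} k<hi lo≤k → h k lo≤k k<hi)
                     (allUpTo? (λ k → (lo ≤? k) →-dec (w k Bool.≟ false)) hi)

Agree : (ℕ → Bool) → (ℕ → Bool) → ℕ → Set
Agree w w′ m = ∀ k → k < m → w k ≡ w′ k

Agree? : ∀ w w′ m → Dec (Agree w w′ m)
Agree? w w′ m = map′ (λ h k k<m → h k<m) (λ h {k} k<m → h k k<m) (allUpTo? (λ k → w k Bool.≟ w′ k) m)

agree-or-firstDifference : ∀ w w′ m → Agree w w′ m ⊎ ∃[ j ] (j < m × w j ≢ w′ j × Agree w w′ j)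
agree-or-firstDifference w w′ zero = inj₁ (λ _ ())
agree-or-firstDifference w w′ (suc m) with agree-or-firstDifference w w′ m
... | inj₂ (j , j<m , wj≢w′j , agree) = inj₂ (j , m≤n⇒m≤1+n j<m , wj≢w′j , agree)
... | inj₁ agree with w m Bool.≟ w′ m
...   | no wm≢w′m = inj₂ (m , ≤-refl , wm≢w′m , agree)
...   | yes wm≡w′m = inj₁ agree′
  where
    agree′ : Agree w w′ (suc m)
    agree′ k k<1+m with m≤n⇒m<n∨m≡n (≤-pred k<1+m)
    ... | inj₁ k<m = agree k k<m
    ... | inj₂ refl = wm≡w′m

afterLast : (ℕ → Bool) → ℕ → ℕ
afterLast f zero = zero
afterLast f (suc m) = if f m then suc m else afterLast f m

afterLast-≤ : ∀ f m → afterLast f m ≤ m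
afterLast-≤ f zero = z≤n
afterLast-≤ f (suc m) with f m
... | true = ≤-refl
... | false = m≤n⇒m≤1+n (afterLast-≤ f m)

afterLast-none : ∀ f m → None f (afterLast f m) m
afterLast-none f (suc m) j ℓ≤j j<1+m with f m in fm
... | true = contradiction (≤-<-trans ℓ≤j j<1+m) (<-irrefl refl)
... | false with m≤n⇒m<n∨m≡n (≤-pred j<1+m)
...   | inj₁ j<m = afterLast-none f m j ℓ≤j j<m
...   | inj₂ refl = fm

afterLast-true : ∀ f m {k} → afterLast f m ≡ suc k → f k ≡ true
afterLast-true f (suc m) ℓ≡1+k with f m in fm
... | true = subst (λ x → f x ≡ true) (suc-injective ℓ≡1+k) fm
... | false = afterLast-true f m ℓ≡1+k

afterLast-> : ∀ f m {j} → f j ≡ true → j < m → j < afterLast f m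
afterLast-> f m {j} fj j<m with j <? afterLast f m
... | yes j<ℓ = j<ℓ
... | no j≮ℓ = contradiction (afterLast-none f m j (≮⇒≥ j≮ℓ) j<m) (≡true⇒≢false fj)

record NextTrue (f : ℕ → Bool) (lo hi : ℕ) : Set where
  field
    at : ℕ
    lo≤at : lo ≤ at
    at≤hi : at ≤ hi
    hit : at ≡ hi ⊎ f at ≡ true
    none-before : None f lo at

nextTrue : ∀ f lo hi → lo ≤ hi → NextTrue f lo hi
nextTrue f lo hi lo≤hi = go (hi ∸ lo) lo (m+[n∸m]≡n lo≤hi)
  where
    go : ∀ d lo → lo + d ≡ hi → NextTrue f lo hi
    go zero lo lo+0≡hi = record
      { at = lo ; lo≤at = ≤-refl ; at≤hi = ≤-reflexive lo≡hi ; hit = inj₁ lo≡hi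
      ; none-before = λ k lo≤k k<lo → contradiction (≤-<-trans lo≤k k<lo) (<-irrefl refl) }
      where lo≡hi = trans (sym (+-identityʳ lo)) lo+0≡hi
    go (suc d) lo lo+1+d≡hi with f lo in flo
    ... | true = record
      { at = lo ; lo≤at = ≤-refl ; at≤hi = ≤-trans (m≤m+n lo (suc d)) (≤-reflexive lo+1+d≡hi)
      ; hit = inj₂ flo ; none-before = λ k lo≤k k<lo → contradiction (≤-<-trans lo≤k k<lo) (<-irrefl refl) }
    ... | false = record
      { at = at ; lo≤at = <⇒≤ lo≤at ; at≤hi = at≤hi ; hit = hit ; none-before = none-before′ }
      where
        open NextTrue (go d (suc lo) (trans (sym (+-suc lo d)) lo+1+d≡hi))
        none-before′ : None f lo at
        none-before′ k lo≤k k<at with m≤n⇒m<n∨m≡n lo≤k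
        ... | inj₁ lo<k = none-before k lo<k k<at
        ... | inj₂ refl = flo

-- Sides, switches and edges

-- A side function s places each inner vertex 2 ≤ k < n on one of the two chains of a tour. The vertices 1
-- and n lie on both chains, so only 2 < k < n can be switches.
switches : ℕ → (ℕ → Bool) → ℕ → Bool
switches n s k = (2 <ᵇ k) ∧ (k <ᵇ n) ∧ (s (pred k) xor s k)

guarded⇒ : ∀ {n k} c → ((2 <ᵇ k) ∧ (k <ᵇ n) ∧ c) ≡ true → 2 < k × k < n × c ≡ true
guarded⇒ {n} {k} c e with 2 <ᵇ k in 2<ᵇk | k <ᵇ n in k<ᵇn
guarded⇒ c e | true | true = true⇒ (<ᵇ-reflects-< _ _) 2<ᵇk , true⇒ (<ᵇ-reflects-< _ _) k<ᵇn , e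
guarded⇒ c () | false | _
guarded⇒ c () | true | false

switch⇒ : ∀ n s {k} → switches n s k ≡ true → 2 < k × k < n × s (pred k) ≢ s k
switch⇒ n s sw = Product.map₂ (Product.map₂ (true⇒ (xor-reflects-≢ _ _))) (guarded⇒ _ sw)

switches-guarded : ∀ {n} s {k} → 2 < k → k < n → switches n s k ≡ (s (pred k) xor s k)
switches-guarded s 2<k k<n rewrite <ᵇ-true 2<k | <ᵇ-true k<n = refl

⇒switch : ∀ {n} s {k} → 2 < k → k < n → s (pred k) ≢ s k → switches n s k ≡ true
⇒switch s 2<k k<n differ = trans (switches-guarded s 2<k k<n) (⇒true (xor-reflects-≢ _ _) differ)

≡⇒noSwitch : ∀ n s k → s (pred k) ≡ s k → switches n s k ≡ false
≡⇒noSwitch n s k same rewrite ⇒false (xor-reflects-≢ (s (pred k)) (s k)) (λ differ → differ same) =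
  trans (cong ((2 <ᵇ k) ∧_) (∧-zeroʳ (k <ᵇ n))) (∧-zeroʳ (2 <ᵇ k))

noSwitch⇒ : ∀ {n} s {k} → 2 < k → k < n → switches n s k ≡ false → s (pred k) ≡ s k
noSwitch⇒ s {k} 2<k k<n noSwitch with s (pred k) Bool.≟ s k
... | yes same = same
... | no differ = contradiction noSwitch (≡true⇒≢false (⇒switch s 2<k k<n differ))

constant-between-switches : ∀ {n s lo hi} → 2 ≤ lo → hi ≤ n → None (switches n s) (suc lo) hi →
                            ∀ k → lo ≤ k → k < hi → s k ≡ s lo
constant-between-switches 2≤lo hi≤n none k lo≤k k<hi with m≤n⇒m<n∨m≡n lo≤k
... | inj₂ refl = refl
constant-between-switches {s = s} 2≤lo hi≤n none (suc k) _ k<hi | inj₁ (s≤s lo≤k) =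
  trans (sym (noSwitch⇒ s (s≤s (≤-trans 2≤lo lo≤k)) (≤-trans k<hi hi≤n) (none (suc k) (s≤s lo≤k) k<hi)))
        (constant-between-switches 2≤lo hi≤n none k lo≤k (<-trans (n<1+n k) k<hi))

-- The edges {i, j}, i < j, of the tour with switch function w: a long edge jumps over the switch-free run
-- i + 1, …, j - 1 of the other chain.
ShortEdge LongEdge Edge : ℕ → (ℕ → Bool) → ℕ → ℕ → Set
ShortEdge n w i j = i ≡ 1 ⊎ j ≡ n ⊎ w j ≡ false
LongEdge n w i j = (i ≡ 1 ⊎ w (suc i) ≡ true) × (j ≡ n ⊎ w j ≡ true) × None w (suc (suc i)) j
Edge n w i j = (j ≡ suc i × ShortEdge n w i j) ⊎ (j ≢ suc i × LongEdge n w i j)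

Edge? : ∀ n w i j → Dec (Edge n w i j)
Edge? n w i j =
  (j ≟ suc i ×-dec (i ≟ 1 ⊎-dec j ≟ n ⊎-dec w j Bool.≟ false)) ⊎-dec
  (¬? (j ≟ suc i) ×-dec (i ≟ 1 ⊎-dec w (suc i) Bool.≟ true) ×-dec (j ≟ n ⊎-dec w j Bool.≟ true) ×-dec
                         None? w (suc (suc i)) j)

Edge-cong : ∀ {n w w′ i j} → i < j → (∀ k → i < k → k ≤ j → w k ≡ w′ k) → Edge n w i j → Edge n w′ i j
Edge-cong i<j w≡w′ (inj₁ (refl , short)) = inj₁ (refl , Sum.map₂ (Sum.map₂ (trans (sym (w≡w′ _ i<j ≤-refl)))) short)
Edge-cong {i = i} i<j w≡w′ (inj₂ (j≢1+i , first , last , none)) =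
  inj₂ (j≢1+i , Sum.map₂ (trans (sym (w≡w′ (suc i) ≤-refl i<j))) first ,
                Sum.map₂ (trans (sym (w≡w′ _ i<j ≤-refl))) last ,
        λ k 2+i≤k k<j → trans (sym (w≡w′ k (≤-trans (n≤1+n (suc i)) 2+i≤k) (<⇒≤ k<j))) (none k 2+i≤k k<j))

Reflects-Edge-cong : ∀ {n w w′ i j b} → i < j → (∀ k → i < k → k ≤ j → w k ≡ w′ k) →
                     Reflects (Edge n w i j) b → Reflects (Edge n w′ i j) b
Reflects-Edge-cong i<j w≡w′ = Reflects-map (Edge-cong i<j w≡w′) (Edge-cong i<j (λ k i<k k≤j → sym (w≡w′ k i<k k≤j)))

¬Edge-across : ∀ {n w i j x} → suc i < x → x < j → w x ≡ true → ¬ Edge n w i j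
¬Edge-across 1+i<x x<j _ (inj₁ (refl , _)) = contradiction (<-trans 1+i<x x<j) (<-irrefl refl)
¬Edge-across 1+i<x x<j wx (inj₂ (_ , _ , _ , none)) = ≡true⇒≢false wx (none _ 1+i<x x<j)

OnSide : ℕ → (ℕ → Bool) → Bool → ℕ → Set
OnSide n s b k = k ≡ 1 ⊎ k ≡ n ⊎ s k ≡ b

-- i and j are neighbours on the chain of side not b: all vertices strictly between them lie on side b.
Hop : ℕ → (ℕ → Bool) → Bool → ℕ → ℕ → Set
Hop n s b i j = OnSide n s (not b) i × OnSide n s (not b) j × (∀ k → i < k → k < j → s k ≡ b)

module _ {n : ℕ} {s : ℕ → Bool} {i j : ℕ} (1≤i : 1 ≤ i) (i<j : i < j) (j≤n : j ≤ n) where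

  private
    1+i≤n : suc i ≤ n
    1+i≤n = ≤-trans i<j j≤n

    2≤i : i ≢ 1 → 2 ≤ i
    2≤i i≢1 = ≤∧≢⇒< 1≤i (i≢1 ∘ sym)

    2≤j : 2 ≤ j
    2≤j = ≤-trans (s≤s 1≤i) i<j

    no-inside : ∀ {b} k → i < k → k < suc i → s k ≡ b
    no-inside k i<k k<1+i = contradiction (≤-pred k<1+i) (<⇒≱ i<k)

  Hop⇒Edge : ∀ {b} → Hop n s b i j → Edge n (switches n s) i j
  Hop⇒Edge {b} (side-i , side-j , inside) with j ≟ suc i
  ... | yes refl = inj₁ (refl , short side-i side-j)
    where
      short : OnSide n s (not b) i → OnSide n s (not b) j → ShortEdge n (switches n s) i j
      short (inj₁ i≡1) _ = inj₁ i≡1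
      short (inj₂ (inj₁ refl)) _ = contradiction 1+i≤n (<-irrefl refl)
      short (inj₂ (inj₂ _)) (inj₁ j≡1) = contradiction (subst (2 ≤_) j≡1 2≤j) λ { (s≤s ()) }
      short (inj₂ (inj₂ _)) (inj₂ (inj₁ j≡n)) = inj₂ (inj₁ j≡n)
      short (inj₂ (inj₂ si)) (inj₂ (inj₂ sj)) = inj₂ (inj₂ (≡⇒noSwitch n s j (trans si (sym sj))))
  ... | no j≢1+i = inj₂ (j≢1+i , first side-i , last side-j , none)
    where
      2+i≤j : suc (suc i) ≤ j
      2+i≤j = ≤∧≢⇒< i<j (j≢1+i ∘ sym)

      first : OnSide n s (not b) i → i ≡ 1 ⊎ switches n s (suc i) ≡ true
      first (inj₁ i≡1) = inj₁ i≡1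
      first (inj₂ (inj₁ refl)) = contradiction 1+i≤n (<-irrefl refl)
      first (inj₂ (inj₂ si)) with i ≟ 1
      ... | yes i≡1 = inj₁ i≡1
      ... | no i≢1 = inj₂ (⇒switch s (s≤s (2≤i i≢1)) (≤-trans 2+i≤j j≤n)
                             (λ si≡s1+i → not-¬ refl (trans (sym si≡s1+i)
                                                     (trans si (cong not (sym (inside (suc i) ≤-refl 2+i≤j)))))))

      last : OnSide n s (not b) j → j ≡ n ⊎ switches n s j ≡ true
      last (inj₁ j≡1) = contradiction (subst (2 ≤_) j≡1 2≤j) λ { (s≤s ()) }
      last (inj₂ (inj₁ j≡n)) = inj₁ j≡n
      last (inj₂ (inj₂ sj)) with j ≟ n
      ... | yes j≡n = inj₁ j≡n
      last (inj₂ (inj₂ sj)) | no j≢n =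
        inj₂ (⇒switch s (≤-trans (s≤s (s≤s 1≤i)) 2+i≤j) (≤∧≢⇒< j≤n j≢n)
                      (λ spj≡sj → not-¬ refl (trans (sym (inside (pred j) i<pj pj<j)) (trans spj≡sj sj))))
        where
          i<pj = proj₁ (pred-between 2+i≤j)
          pj<j = proj₂ (pred-between 2+i≤j)

      none : None (switches n s) (suc (suc i)) j
      none (suc k) (s≤s 1+i≤k) k<j =
        ≡⇒noSwitch n s (suc k) (trans (inside k 1+i≤k (<-trans (n<1+n k) k<j)) (sym (inside (suc k) (m≤n⇒m≤1+n 1+i≤k) k<j)))

  Edge⇒Hop : Edge n (switches n s) i j → ∃[ b ] Hop n s b i j
  Edge⇒Hop (inj₁ (refl , short)) with i ≟ 1 | j ≟ n
  ... | yes i≡1 | _ = not (s j) , inj₁ i≡1 , inj₂ (inj₂ (sym (not-involutive (s j)))) , no-inside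
  ... | no _ | yes j≡n = not (s i) , inj₂ (inj₂ (sym (not-involutive (s i)))) , inj₂ (inj₁ j≡n) , no-inside
  ... | no i≢1 | no j≢n with short
  ...   | inj₁ i≡1 = contradiction i≡1 i≢1
  ...   | inj₂ (inj₁ j≡n) = contradiction j≡n j≢n
  ...   | inj₂ (inj₂ noSwitch) =
    not (s i) , inj₂ (inj₂ (sym (not-involutive (s i)))) ,
    inj₂ (inj₂ (trans (sym (noSwitch⇒ s (s≤s (2≤i i≢1)) (≤∧≢⇒< j≤n j≢n) noSwitch)) (sym (not-involutive (s i))))) ,
    no-inside
  Edge⇒Hop (inj₂ (j≢1+i , first , last , none)) = s (suc i) , side-i first , side-j last , same-side
    where
      2+i≤j : suc (suc i) ≤ j
      2+i≤j = ≤∧≢⇒< i<j (j≢1+i ∘ sym)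

      same-side : ∀ k → i < k → k < j → s k ≡ s (suc i)
      same-side = constant-between-switches (s≤s 1≤i) j≤n none

      side-i : i ≡ 1 ⊎ switches n s (suc i) ≡ true → OnSide n s (not (s (suc i))) i
      side-i (inj₁ i≡1) = inj₁ i≡1
      side-i (inj₂ sw) = inj₂ (inj₂ (¬-not (proj₂ (proj₂ (switch⇒ n s sw)))))

      side-j : j ≡ n ⊎ switches n s j ≡ true → OnSide n s (not (s (suc i))) j
      side-j (inj₁ j≡n) = inj₂ (inj₁ j≡n)
      side-j (inj₂ sw) = inj₂ (inj₂ (¬-not (λ sj≡s1+i → differ (trans (same-side (pred j) i<pj pj<j) (sym sj≡s1+i)))))
        where
          i<pj = proj₁ (pred-between 2+i≤j)
          pj<j = proj₂ (pred-between 2+i≤j)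
          differ = proj₂ (proj₂ (switch⇒ n s sw))

-- Characteristic vectors of pyramidal tours

joins : ℕ → ℕ → ℕ × ℕ → Bool
joins i j p = ((proj₁ p ≡ᵇ i) ∧ (proj₂ p ≡ᵇ j)) ∨ ((proj₁ p ≡ᵇ j) ∧ (proj₂ p ≡ᵇ i))

joins-reflects : ∀ i j a b → Reflects ((a ≡ i × b ≡ j) ⊎ (a ≡ j × b ≡ i)) (joins i j (a , b))
joins-reflects i j a b =
  (≡ᵇ-reflects-≡ a i ×-reflects ≡ᵇ-reflects-≡ b j) ⊎-reflects (≡ᵇ-reflects-≡ a j ×-reflects ≡ᵇ-reflects-≡ b i)

charVec-true⇒ : ∀ t {i j} → charVec t (i , j) ≡ true → (i , j) ∈ cyclicPairs t ⊎ (j , i) ∈ cyclicPairs t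
charVec-true⇒ t {i} {j} e with any-true⇒ (joins i j) (cyclicPairs t) e
... | (a , b) , ab∈ , ab-joins with true⇒ (joins-reflects i j a b) ab-joins
...   | inj₁ (refl , refl) = inj₁ ab∈
...   | inj₂ (refl , refl) = inj₂ ab∈

⇒charVec-true : ∀ t {i j} → (i , j) ∈ cyclicPairs t ⊎ (j , i) ∈ cyclicPairs t → charVec t (i , j) ≡ true
⇒charVec-true t {i} {j} (inj₁ ij∈) = ⇒any-true (joins i j) ij∈ (⇒true (joins-reflects i j i j) (inj₁ (refl , refl)))
⇒charVec-true t {i} {j} (inj₂ ji∈) = ⇒any-true (joins i j) ji∈ (⇒true (joins-reflects i j j i) (inj₂ (refl , refl)))

∈-vertices⁻ : ∀ {n k} → k ∈ vertices n → 1 ≤ k × k ≤ n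
∈-vertices⁻ k∈ with ∈-map⁻ suc k∈
... | _ , i∈ , refl = s≤s z≤n , ∈-upTo⁻ i∈

∈-vertices⁺ : ∀ {n k} → 1 ≤ k → k ≤ n → k ∈ vertices n
∈-vertices⁺ {k = suc k} _ k<n = ∈-map⁺ suc (∈-upTo⁺ k<n)

vertices-distinct : ∀ n → AllPairs _≢_ (vertices n)
vertices-distinct n = Unique.map⁺ suc-injective (Unique.upTo⁺ n)

-- The tour 1, is, n, js is the union of the chains 1, is, n and n, js, 1; side k tells whether k lies in is.
module PyramidalTour {n : ℕ} {is js : List ℕ} (ascending : Linked _<_ is) (descending : Linked (flip _<_) js)
                     (perm : 1 ∷ is ++ n ∷ js ↭ vertices n) where

  side : ℕ → Bool
  side k = does (k ∈? is)

  private
    t up down : List ℕ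
    t = 1 ∷ is ++ n ∷ js
    up = 1 ∷ is ++ [ n ]
    down = n ∷ js ++ [ 1 ]

    distinct : AllPairs _≢_ t
    distinct = Unique-resp-↭ (↭⇒↭ₛ (↭-sym perm)) (vertices-distinct n)

    ∈t⁻ : ∀ {k} → k ∈ t → 1 ≤ k × k ≤ n
    ∈t⁻ k∈ = ∈-vertices⁻ (∈-resp-↭ perm k∈)

    ∈t⁺ : ∀ {k} → 1 ≤ k → k ≤ n → k ∈ t
    ∈t⁺ 1≤k k≤n = ∈-resp-↭ (↭-sym perm) (∈-vertices⁺ 1≤k k≤n)

    1∉rest : ∀ {k} → k ∈ is ++ n ∷ js → 1 ≢ k
    1∉rest = All.lookup (AllPairs.head distinct)

    is∉n∷js : ∀ {k} → k ∈ is → k ∉ n ∷ js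
    is∉n∷js k∈is k∈n∷js = AllPairs-across is (AllPairs.tail distinct) k∈is k∈n∷js refl

    n∉js : ∀ {k} → k ∈ js → n ≢ k
    n∉js = All.lookup (AllPairs.head (AllPairs-++⁻ʳ is (AllPairs.tail distinct)))

    inner-range : ∀ {k} → k ∈ is ++ n ∷ js → k ≢ n → 1 < k × k < n
    inner-range k∈ k≢n with ∈t⁻ (there k∈)
    ... | 1≤k , k≤n = ≤∧≢⇒< 1≤k (1∉rest k∈) , ≤∧≢⇒< k≤n k≢n

    is-range : ∀ {k} → k ∈ is → 1 < k × k < n
    is-range k∈ = inner-range (∈-++⁺ˡ k∈) (is∉n∷js k∈ ∘ here)

    js-range : ∀ {k} → k ∈ js → 1 < k × k < n
    js-range k∈ = inner-range (∈-++⁺ʳ is (there k∈)) (n∉js k∈ ∘ sym)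

    1<n : 1 < n
    1<n = ≤∧≢⇒< (proj₁ (∈t⁻ (there n∈rest))) (1∉rest n∈rest)
      where n∈rest = ∈-++⁺ʳ is (here refl)

    cyclicPairs-split : cyclicPairs t ≡ consecutive up ++ consecutive down
    cyclicPairs-split = begin
      zip t ((is ++ n ∷ js) ++ [ 1 ])             ≡⟨ zip-consecutive 1 (is ++ n ∷ js) 1 ⟩
      consecutive (1 ∷ (is ++ n ∷ js) ++ [ 1 ])   ≡⟨ cong (consecutive ∘ (1 ∷_)) (++-assoc is (n ∷ js) [ 1 ]) ⟩
      consecutive ((1 ∷ is) ++ n ∷ js ++ [ 1 ])   ≡⟨ consecutive-++ (1 ∷ is) n (js ++ [ 1 ]) ⟩
      consecutive up ++ consecutive down          ∎
      where open ≡-Reasoning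

    >-trans : Transitive (flip _<_)
    >-trans m>n n>o = <-trans n>o m>n

    up-sorted : AllPairs _<_ up
    up-sorted = AllP.++⁺ (All.tabulate (proj₁ ∘ is-range)) (1<n ∷ [])
              ∷ AllPairs.++⁺ (Linked⇒AllPairs <-trans ascending) ([] ∷ [])
                             (All.tabulate λ k∈ → proj₂ (is-range k∈) ∷ [])

    down-sorted : AllPairs (flip _<_) down
    down-sorted = AllP.++⁺ (All.tabulate (proj₂ ∘ js-range)) (1<n ∷ [])
                ∷ AllPairs.++⁺ (Linked⇒AllPairs >-trans descending) ([] ∷ [])
                               (All.tabulate λ k∈ → proj₁ (js-range k∈) ∷ [])

    ∈up⁻ : ∀ {k} → k ∈ up → OnSide n side true k
    ∈up⁻ (here k≡1) = inj₁ k≡1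
    ∈up⁻ (there k∈) with ∈-++⁻ is k∈
    ... | inj₁ k∈is = inj₂ (inj₂ (⇒true (proof (_ ∈? is)) k∈is))
    ... | inj₂ (here k≡n) = inj₂ (inj₁ k≡n)

    ∈up⁺ : ∀ {k} → OnSide n side true k → k ∈ up
    ∈up⁺ (inj₁ refl) = here refl
    ∈up⁺ (inj₂ (inj₁ refl)) = there (∈-++⁺ʳ is (here refl))
    ∈up⁺ (inj₂ (inj₂ sk)) = there (∈-++⁺ˡ (true⇒ (proof (_ ∈? is)) sk))

    ∈down⁻ : ∀ {k} → k ∈ down → OnSide n side false k
    ∈down⁻ (here k≡n) = inj₂ (inj₁ k≡n)
    ∈down⁻ (there k∈) with ∈-++⁻ js k∈
    ... | inj₁ k∈js = inj₂ (inj₂ (⇒false (proof (_ ∈? is)) (λ k∈is → is∉n∷js k∈is (there k∈js))))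
    ... | inj₂ (here k≡1) = inj₁ k≡1

    ∈down⁺ : ∀ {k} → 1 ≤ k → k ≤ n → OnSide n side false k → k ∈ down
    ∈down⁺ _ _ (inj₁ refl) = there (∈-++⁺ʳ js (here refl))
    ∈down⁺ _ _ (inj₂ (inj₁ refl)) = here refl
    ∈down⁺ 1≤k k≤n (inj₂ (inj₂ sk)) with ∈t⁺ 1≤k k≤n
    ... | here refl = there (∈-++⁺ʳ js (here refl))
    ... | there k∈ with ∈-++⁻ is k∈
    ...   | inj₁ k∈is = contradiction k∈is (false⇒ (proof (_ ∈? is)) sk)
    ...   | inj₂ (here refl) = here refl
    ...   | inj₂ (there k∈js) = there (∈-++⁺ˡ k∈js)

  module _ {i j} (1≤i : 1 ≤ i) (i<j : i < j) (j≤n : j ≤ n) where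

    private
      module Up = Sorted {A = ℕ} {R = _<_} <-trans (<-irrefl refl)
      module Down = Sorted {A = ℕ} {R = flip _<_} >-trans (<-irrefl refl)

      skipped⇒ : ∀ {C b} → (∀ {k} → 1 ≤ k → k ≤ n → OnSide n side (not b) k → k ∈ C) →
                 ∀ k → i < k → k < j → k ∉ C → side k ≡ b
      skipped⇒ {b = b} ∈C⁺ k i<k k<j k∉C with side k Bool.≟ b
      ... | yes sk≡b = sk≡b
      ... | no sk≢b =
        contradiction (∈C⁺ (≤-trans 1≤i (<⇒≤ i<k)) (≤-trans (<⇒≤ k<j) j≤n) (inj₂ (inj₂ (¬-not sk≢b)))) k∉C

      skipped⇐ : ∀ {C b} → (∀ {k} → k ∈ C → OnSide n side (not b) k) →
                 ∀ k → i < k → k < j → side k ≡ b → k ∉ C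
      skipped⇐ ∈C⁻ k i<k k<j sk≡b k∈C with ∈C⁻ k∈C
      ... | inj₁ refl = contradiction (≤-<-trans 1≤i i<k) (<-irrefl refl)
      ... | inj₂ (inj₁ refl) = contradiction (<-≤-trans k<j j≤n) (<-irrefl refl)
      ... | inj₂ (inj₂ sk≡¬b) = not-¬ sk≡b sk≡¬b

      up-hop : (i , j) ∈ consecutive up → Hop n side false i j
      up-hop ij∈ with Up.∈-consecutive⁻ up-sorted ij∈
      ... | i∈ , j∈ , _ , gap =
        ∈up⁻ i∈ , ∈up⁻ j∈ , λ k i<k k<j → skipped⇒ (λ _ _ → ∈up⁺) k i<k k<j (gap k i<k k<j)

      down-hop : (j , i) ∈ consecutive down → Hop n side true i j
      down-hop ji∈ with Down.∈-consecutive⁻ down-sorted ji∈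
      ... | j∈ , i∈ , _ , gap = ∈down⁻ i∈ , ∈down⁻ j∈ , λ k i<k k<j → skipped⇒ ∈down⁺ k i<k k<j (gap k k<j i<k)

      hop⇒charVec : ∃[ b ] Hop n side b i j → charVec t (i , j) ≡ true
      hop⇒charVec (false , side-i , side-j , skipped) =
        ⇒charVec-true t (inj₁ (subst ((i , j) ∈_) (sym cyclicPairs-split) (∈-++⁺ˡ
          (Up.∈-consecutive⁺ up-sorted (∈up⁺ side-i) (∈up⁺ side-j) i<j
            (λ k i<k k<j → skipped⇐ ∈up⁻ k i<k k<j (skipped k i<k k<j))))))
      hop⇒charVec (true , side-i , side-j , skipped) =
        ⇒charVec-true t (inj₂ (subst ((j , i) ∈_) (sym cyclicPairs-split) (∈-++⁺ʳ (consecutive up)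
          (Down.∈-consecutive⁺ down-sorted (∈down⁺ (≤-trans 1≤i (<⇒≤ i<j)) j≤n side-j)
            (∈down⁺ 1≤i (≤-trans (<⇒≤ i<j) j≤n) side-i) i<j
            (λ k k<j i<k → skipped⇐ ∈down⁻ k i<k k<j (skipped k i<k k<j))))))

      charVec⇒hop : charVec t (i , j) ≡ true → ∃[ b ] Hop n side b i j
      charVec⇒hop e with charVec-true⇒ t e
      ... | inj₁ ij∈ with ∈-++⁻ (consecutive up) (subst ((i , j) ∈_) cyclicPairs-split ij∈)
      ...   | inj₁ ij∈up = false , up-hop ij∈up
      ...   | inj₂ ij∈down = contradiction (proj₁ (proj₂ (proj₂ (Down.∈-consecutive⁻ down-sorted ij∈down)))) (<⇒≯ i<j)
      charVec⇒hop e | inj₂ ji∈ with ∈-++⁻ (consecutive up) (subst ((j , i) ∈_) cyclicPairs-split ji∈)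
      ...   | inj₁ ji∈up = contradiction (proj₁ (proj₂ (proj₂ (Up.∈-consecutive⁻ up-sorted ji∈up)))) (<⇒≯ i<j)
      ...   | inj₂ ji∈down = true , down-hop ji∈down

    charVec-reflects-Edge : Reflects (Edge n (switches n side) i j) (charVec t (i , j))
    charVec-reflects-Edge = reflects (Hop⇒Edge {s = side} 1≤i i<j j≤n ∘ proj₂ ∘ charVec⇒hop)
                                     (hop⇒charVec ∘ Edge⇒Hop {s = side} 1≤i i<j j≤n)

sideOf : ∀ {n t} → IsPyramidalTour n t → ℕ → Bool
sideOf (is , _) k = does (k ∈? is)

charVec-reflects-Edge : ∀ {n t} (P : IsPyramidalTour n t) {i j} → 1 ≤ i → i < j → j ≤ n →
                        Reflects (Edge n (switches n (sideOf P)) i j) (charVec t (i , j))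
charVec-reflects-Edge (_ , _ , refl , ascending , descending , perm) = PyramidalTour.charVec-reflects-Edge ascending descending perm

-- Unlike sideOf, this depends only on the characteristic vector.
tourSwitches : ℕ → List ℕ → ℕ → Bool
tourSwitches n t k = (2 <ᵇ k) ∧ (k <ᵇ n) ∧ not (charVec t (pred k , k))

tourSwitches-outside : ∀ n t {k} → k ≤ 2 ⊎ n ≤ k → tourSwitches n t k ≡ false
tourSwitches-outside n t {k} (inj₁ k≤2) rewrite <ᵇ-false (≤⇒≯ k≤2) = refl
tourSwitches-outside n t {k} (inj₂ n≤k) rewrite <ᵇ-false (≤⇒≯ n≤k) = ∧-zeroʳ (2 <ᵇ k)

tourSwitch⇒ : ∀ {n t k} → tourSwitches n t k ≡ true → 2 < k × k < n
tourSwitch⇒ sw = Product.map₂ proj₁ (guarded⇒ _ sw)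

module _ {n t} (P : IsPyramidalTour n t) where

  private
    charVec-step : ∀ {k} → 2 < k → k < n → charVec t (pred k , k) ≡ not (switches n (sideOf P) k)
    charVec-step {suc k} (s≤s 1<k) 1+k<n = ≡-from-≡true (cong not ∘ avoided ∘ true⇒ r) (⇒true r ∘ step ∘ not-injective)
      where
        r = charVec-reflects-Edge P (<⇒≤ 1<k) (n<1+n k) (<⇒≤ 1+k<n)

        step : switches n (sideOf P) (suc k) ≡ false → Edge n (switches n (sideOf P)) k (suc k)
        step noSwitch = inj₁ (refl , inj₂ (inj₂ noSwitch))

        avoided : Edge n (switches n (sideOf P)) k (suc k) → switches n (sideOf P) (suc k) ≡ false
        avoided (inj₁ (_ , inj₁ refl)) = contradiction 1<k (<-irrefl refl)
        avoided (inj₁ (_ , inj₂ (inj₁ refl))) = contradiction 1+k<n (<-irrefl refl)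
        avoided (inj₁ (_ , inj₂ (inj₂ noSwitch))) = noSwitch
        avoided (inj₂ (1+k≢1+k , _)) = contradiction refl 1+k≢1+k

  tourSwitches≗switches : ∀ k → tourSwitches n t k ≡ switches n (sideOf P) k
  tourSwitches≗switches k = ∧-cong-guarded (2 <ᵇ k) (k <ᵇ n) λ 2<ᵇk k<ᵇn →
    let 2<k = true⇒ (<ᵇ-reflects-< 2 k) 2<ᵇk
        k<n = true⇒ (<ᵇ-reflects-< k n) k<ᵇn
    in trans (cong not (charVec-step 2<k k<n)) (trans (not-involutive _) (switches-guarded (sideOf P) 2<k k<n))

  charVec-reflects-tourEdge : ∀ {i j} → 1 ≤ i → i < j → j ≤ n → Reflects (Edge n (tourSwitches n t) i j) (charVec t (i , j))
  charVec-reflects-tourEdge 1≤i i<j j≤n =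
    Reflects-Edge-cong i<j (λ k _ _ → sym (tourSwitches≗switches k)) (charVec-reflects-Edge P 1≤i i<j j≤n)

∈-edgesK⁻ : ∀ {n i j} → (i , j) ∈ edgesK n → 1 ≤ i × i < j × j ≤ n
∈-edgesK⁻ {n} e∈ with ∈-filter⁻ (λ e → proj₁ e <? proj₂ e) {xs = cartesianProduct (vertices n) (vertices n)} e∈
... | e∈K , i<j with ∈-cartesianProduct⁻ (vertices n) (vertices n) e∈K
... | i∈ , j∈ = proj₁ (∈-vertices⁻ i∈) , i<j , proj₂ (∈-vertices⁻ j∈)

∈-edgesK⁺ : ∀ {n i j} → 1 ≤ i → i < j → j ≤ n → (i , j) ∈ edgesK n
∈-edgesK⁺ 1≤i i<j j≤n =
  ∈-filter⁺ (λ e → proj₁ e <? proj₂ e)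
    (∈-cartesianProduct⁺ (∈-vertices⁺ 1≤i (≤-trans (<⇒≤ i<j) j≤n)) (∈-vertices⁺ (≤-trans 1≤i (<⇒≤ i<j)) j≤n))
    i<j

sameSwitches⇒SameVec : ∀ {n t t′} → IsPyramidalTour n t → IsPyramidalTour n t′ →
                       (∀ k → tourSwitches n t k ≡ tourSwitches n t′ k) → SameVec n t t′
sameSwitches⇒SameVec P P′ same (i , j) e∈ with ∈-edgesK⁻ e∈
... | 1≤i , i<j , j≤n =
  det (charVec-reflects-tourEdge P 1≤i i<j j≤n)
      (Reflects-Edge-cong i<j (λ k _ _ → sym (same k)) (charVec-reflects-tourEdge P′ 1≤i i<j j≤n))

SameVec⇒sameSwitches : ∀ {n} t t′ → SameVec n t t′ → ∀ k → tourSwitches n t k ≡ tourSwitches n t′ k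
SameVec⇒sameSwitches {n} _ _ same k = ∧-cong-guarded (2 <ᵇ k) (k <ᵇ n) λ 2<ᵇk k<ᵇn →
  cong not (same (pred k , k) (step-edge (true⇒ (<ᵇ-reflects-< 2 k) 2<ᵇk) (true⇒ (<ᵇ-reflects-< k n) k<ᵇn)))
  where
    step-edge : ∀ {k} → 2 < k → k < n → (pred k , k) ∈ edgesK n
    step-edge {suc k} (s≤s 1<k) k<n = ∈-edgesK⁺ (<⇒≤ 1<k) ≤-refl (<⇒≤ k<n)

onTrueSide : (s : ℕ → Bool) → U.Decidable (λ k → s k ≡ true)
onTrueSide s k = s k Bool.≟ true

tourOfSides : ℕ → (ℕ → Bool) → List ℕ
tourOfSides n s = 1 ∷ filter (onTrueSide s) (applyUpTo (2 +_) (n ∸ 2))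
               ++ n ∷ filter (¬? ∘ onTrueSide s) (applyDownFrom (2 +_) (n ∸ 2))

tourOfSides-pyramidal : ∀ {n} s → 2 ≤ n → IsPyramidalTour n (tourOfSides n s)
tourOfSides-pyramidal {suc zero} s (s≤s ())
tourOfSides-pyramidal {suc (suc m)} s _ =
  is , js , refl , AllPairs⇒Linked (AllPairs.filter⁺ (onTrueSide s) inner-ascending) ,
  AllPairs⇒Linked (AllPairs.filter⁺ (¬? ∘ onTrueSide s) inner-descending) , perm
  where
    inner = applyUpTo (2 +_) m
    is = filter (onTrueSide s) inner
    js = filter (¬? ∘ onTrueSide s) (applyDownFrom (2 +_) m)

    inner-ascending : AllPairs _<_ inner
    inner-ascending = AllPairs.applyUpTo⁺₁ (2 +_) m (λ i<j _ → s≤s (s≤s i<j))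

    inner-descending : AllPairs (flip _<_) (applyDownFrom (2 +_) m)
    inner-descending = AllPairs.applyDownFrom⁺₁ (2 +_) m (λ j<i _ → s≤s (s≤s j<i))

    down↭up : applyDownFrom (2 +_) m ↭ inner
    down↭up = subst (_↭ inner) (reverse-applyUpTo (2 +_) m) (↭-reverse inner)

    split : inner ↭ is ++ filter (¬? ∘ onTrueSide s) inner
    split = subst (λ p → inner ↭ proj₁ p ++ proj₂ p) (partition-defn (onTrueSide s) inner)
                  (↭ₛ⇒↭ (partition-↭ (onTrueSide s) inner))

    perm : 1 ∷ is ++ suc (suc m) ∷ js ↭ vertices (suc (suc m))
    perm = begin
      1 ∷ is ++ suc (suc m) ∷ js                             ↭⟨ prep 1 (shift (suc (suc m)) is js) ⟩
      1 ∷ suc (suc m) ∷ is ++ js                             ↭⟨ prep 1 (∷↭∷ʳ (suc (suc m)) (is ++ js)) ⟩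
      1 ∷ (is ++ js) ∷ʳ suc (suc m)                          ↭⟨ prep 1 (++⁺ʳ [ suc (suc m) ] (++⁺ˡ is (filter-↭ _ down↭up))) ⟩
      1 ∷ (is ++ filter (¬? ∘ onTrueSide s) inner) ∷ʳ suc (suc m) ↭⟨ prep 1 (++⁺ʳ [ suc (suc m) ] (↭-sym split)) ⟩
      1 ∷ inner ∷ʳ suc (suc m)                               ≡⟨ cong (1 ∷_) (applyUpTo-∷ʳ (2 +_) m) ⟩
      applyUpTo suc (suc (suc m))                            ≡⟨ sym (map-upTo suc (suc (suc m))) ⟩
      vertices (suc (suc m))                                 ∎
      where open PermutationReasoning

switches-cong : ∀ {n s s′} → (∀ j → 2 ≤ j → j < n → s j ≡ s′ j) → ∀ k → switches n s k ≡ switches n s′ k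
switches-cong {n} {s} {s′} s≡s′ k = ∧-cong-guarded (2 <ᵇ k) (k <ᵇ n) λ 2<ᵇk k<ᵇn →
  same-xor (true⇒ (<ᵇ-reflects-< 2 k) 2<ᵇk) (true⇒ (<ᵇ-reflects-< k n) k<ᵇn)
  where
    same-xor : ∀ {k} → 2 < k → k < n → (s (pred k) xor s k) ≡ (s′ (pred k) xor s′ k)
    same-xor {suc k} (s≤s 2≤k) 1+k<n =
      cong₂ _xor_ (s≡s′ k 2≤k (<-trans (n<1+n k) 1+k<n)) (s≡s′ (suc k) (m≤n⇒m≤1+n 2≤k) 1+k<n)

tourSwitches-tourOfSides : ∀ {n} s → 2 ≤ n → ∀ k → tourSwitches n (tourOfSides n s) k ≡ switches n s k
tourSwitches-tourOfSides {suc zero} s (s≤s ()) k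
tourSwitches-tourOfSides {suc (suc m)} s 2≤n k =
  trans (tourSwitches≗switches P k) (switches-cong side≡s k)
  where
    P = tourOfSides-pyramidal s 2≤n

    side≡s : ∀ j → 2 ≤ j → j < suc (suc m) → sideOf P j ≡ s j
    side≡s (suc zero) (s≤s ()) _
    side≡s (suc (suc i)) _ (s≤s (s≤s i<m)) =
      ≡-from-≡true (λ e → proj₂ (∈-filter⁻ (onTrueSide s) {xs = applyUpTo (2 +_) m} (true⇒ (proof (_ ∈? _)) e)))
                   (λ e → ⇒true (proof (_ ∈? _)) (∈-filter⁺ (onTrueSide s) (∈-applyUpTo⁺ (2 +_) i<m) e))

-- Linear functionals

count : Bool → ℕ
count b = if b then 1 else 0

module _ where

  open import Data.Rational using (ℚ; 0ℚ) renaming (_+_ to _+ℚ_; _<_ to _<ℚ_; _≤_ to _≤ℚ_)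
  open import Algebra.Properties.CommutativeSemigroup (CommutativeMonoid.commutativeSemigroup ℚ.+-0-commutativeMonoid)
    using (interchange)

  -- eval n is evalOn (edgesK n); the list of edges is generalised for induction.
  evalOn : List (ℕ × ℕ) → (ℕ × ℕ → ℚ) → List ℕ → ℚ
  evalOn L c t = foldr (λ e acc → (if charVec t e then c e else 0ℚ) +ℚ acc) 0ℚ L

  private
    multiple : ℕ → ℚ → ℚ
    multiple zero x = 0ℚ
    multiple (suc zero) x = x
    multiple (suc (suc _)) x = x +ℚ x

    two-terms : ∀ a b x → (if a then x else 0ℚ) +ℚ (if b then x else 0ℚ) ≡ multiple (count a + count b) x
    two-terms true true x = refl
    two-terms true false x = ℚ.+-identityʳ x
    two-terms false true x = ℚ.+-identityˡ x
    two-terms false false x = ℚ.+-identityˡ 0ℚ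

    term≤0 : ∀ b {x} → x ≤ℚ 0ℚ → (if b then x else 0ℚ) ≤ℚ 0ℚ
    term≤0 true x≤0 = x≤0
    term≤0 false _ = ℚ.≤-refl

  evalOn-exchange : ∀ L c F G t t′ →
    (∀ e → e ∈ L → count (charVec F e) + count (charVec G e) ≡ count (charVec t e) + count (charVec t′ e)) →
    evalOn L c F +ℚ evalOn L c G ≡ evalOn L c t +ℚ evalOn L c t′
  evalOn-exchange [] c F G t t′ _ = refl
  evalOn-exchange (e ∷ L) c F G t t′ counts = begin
    (term F +ℚ evalOn L c F) +ℚ (term G +ℚ evalOn L c G) ≡⟨ interchange (term F) _ (term G) _ ⟩
    (term F +ℚ term G) +ℚ (evalOn L c F +ℚ evalOn L c G) ≡⟨ cong₂ _+ℚ_ same-term (evalOn-exchange L c F G t t′ (λ e′ → counts e′ ∘ there)) ⟩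
    (term t +ℚ term t′) +ℚ (evalOn L c t +ℚ evalOn L c t′) ≡⟨ interchange (term t) (term t′) _ _ ⟩
    (term t +ℚ evalOn L c t) +ℚ (term t′ +ℚ evalOn L c t′) ∎
    where
      open ≡-Reasoning
      term : List ℕ → ℚ
      term u = if charVec u e then c e else 0ℚ
      same-term : term F +ℚ term G ≡ term t +ℚ term t′
      same-term = begin
        term F +ℚ term G                                    ≡⟨ two-terms (charVec F e) (charVec G e) (c e) ⟩
        multiple (count (charVec F e) + count (charVec G e)) (c e) ≡⟨ cong (λ k → multiple k (c e)) (counts e (here refl)) ⟩
        multiple (count (charVec t e) + count (charVec t′ e)) (c e) ≡⟨ two-terms (charVec t e) (charVec t′ e) (c e) ⟨
        term t +ℚ term t′                                   ∎

  evalOn-zero : ∀ L c t → (∀ e → e ∈ L → charVec t e ≡ true → c e ≡ 0ℚ) → evalOn L c t ≡ 0ℚ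
  evalOn-zero [] c t _ = refl
  evalOn-zero (e ∷ L) c t vanish with charVec t e in te
  ... | true rewrite vanish e (here refl) te = trans (ℚ.+-identityˡ _) (evalOn-zero L c t (λ e′ → vanish e′ ∘ there))
  ... | false = trans (ℚ.+-identityˡ _) (evalOn-zero L c t (λ e′ → vanish e′ ∘ there))

  evalOn≤0 : ∀ L c t → (∀ e → c e ≤ℚ 0ℚ) → evalOn L c t ≤ℚ 0ℚ
  evalOn≤0 [] c t _ = ℚ.≤-refl
  evalOn≤0 (e ∷ L) c t c≤0 =
    subst (evalOn (e ∷ L) c t ≤ℚ_) (ℚ.+-identityˡ 0ℚ) (ℚ.+-mono-≤ (term≤0 (charVec t e) (c≤0 e)) (evalOn≤0 L c t c≤0))

  evalOn<0 : ∀ L c t → (∀ e → c e ≤ℚ 0ℚ) → ∀ {e} → e ∈ L → charVec t e ≡ true → c e <ℚ 0ℚ → evalOn L c t <ℚ 0ℚ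
  evalOn<0 (e ∷ L) c t c≤0 (here refl) te ce<0 rewrite te =
    subst (c e +ℚ evalOn L c t <ℚ_) (ℚ.+-identityˡ 0ℚ) (ℚ.+-mono-<-≤ ce<0 (evalOn≤0 L c t c≤0))
  evalOn<0 (e′ ∷ L) c t c≤0 (there e∈) te ce<0 =
    subst (evalOn (e′ ∷ L) c t <ℚ_) (ℚ.+-identityˡ 0ℚ)
          (ℚ.+-mono-≤-< (term≤0 (charVec t e′) (c≤0 e′)) (evalOn<0 L c t c≤0 e∈ te ce<0))

-- Crossings

Crossing : (ℕ → Bool) → (ℕ → Bool) → Set
Crossing w w′ = ∃[ x ] ∃[ p ] ∃[ q ] (p < x × x < q × w x ≡ true × w′ x ≡ true × w p ≢ w′ p × w q ≢ w′ q)

Crossing-irrefl : ∀ {w} → ¬ Crossing w w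
Crossing-irrefl (_ , _ , _ , _ , _ , _ , _ , p-differs , _) = p-differs refl

Crossing-sym : ∀ {w w′} → Crossing w w′ → Crossing w′ w
Crossing-sym (x , p , q , p<x , x<q , wx , w′x , p-differs , q-differs) =
  x , p , q , p<x , x<q , w′x , wx , p-differs ∘ sym , q-differs ∘ sym

record Spliced (x : ℕ) (w w′ u : ℕ → Bool) : Set where
  field
    below : ∀ k → k < x → u k ≡ w k
    above : ∀ k → x < k → u k ≡ w′ k
    at : u x ≡ true

  up-to : w x ≡ true → ∀ k → k ≤ x → u k ≡ w k
  up-to wx k k≤x with m≤n⇒m<n∨m≡n k≤x
  ... | inj₁ k<x = below k k<x
  ... | inj₂ refl = trans at (sym wx)

  from : w′ x ≡ true → ∀ k → x ≤ k → u k ≡ w′ k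
  from w′x k x≤k with m≤n⇒m<n∨m≡n x≤k
  ... | inj₁ x<k = above k x<k
  ... | inj₂ refl = trans at (sym w′x)

Spliced-resp : ∀ {x w w′ u v v′ u′} → (∀ k → w k ≡ v k) → (∀ k → w′ k ≡ v′ k) → (∀ k → u k ≡ u′ k) →
               Spliced x w w′ u → Spliced x v v′ u′
Spliced-resp w≗v w′≗v′ u≗u′ spliced = record
  { below = λ k k<x → trans (sym (u≗u′ k)) (trans (below k k<x) (w≗v k))
  ; above = λ k x<k → trans (sym (u≗u′ k)) (trans (above k x<k) (w′≗v′ k))
  ; at = trans (sym (u≗u′ _)) at }
  where open Spliced spliced

-- Splicing w and w′ at a common switch x in both orders uses every edge as often as w and w′ together do.
exchange : ∀ {n x i j} {w w′ wF wG : ℕ → Bool} {b b′ bF bG : Bool} → i < j →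
           Reflects (Edge n w i j) b → Reflects (Edge n w′ i j) b′ →
           Reflects (Edge n wF i j) bF → Reflects (Edge n wG i j) bG →
           w x ≡ true → w′ x ≡ true → Spliced x w w′ wF → Spliced x w′ w wG →
           count bF + count bG ≡ count b + count b′
exchange {x = x} {i} {j} {b = b} {b′} i<j r r′ rF rG wx w′x F G with j ≤? x | x ≤? suc i
... | yes j≤x | _ =
  cong₂ (λ a c → count a + count c)
        (det rF (Reflects-Edge-cong i<j (λ k _ k≤j → sym (F.up-to wx k (≤-trans k≤j j≤x))) r))
        (det rG (Reflects-Edge-cong i<j (λ k _ k≤j → sym (G.up-to w′x k (≤-trans k≤j j≤x))) r′))
  where module F = Spliced F; module G = Spliced G
... | no _ | yes x≤1+i =
  trans (cong₂ (λ a c → count a + count c)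
               (det rF (Reflects-Edge-cong i<j (λ k i<k _ → sym (F.from w′x k (≤-trans x≤1+i i<k))) r′))
               (det rG (Reflects-Edge-cong i<j (λ k i<k _ → sym (G.from wx k (≤-trans x≤1+i i<k))) r)))
        (+-comm (count b′) (count b))
  where module F = Spliced F; module G = Spliced G
... | no j≰x | no x≰1+i
  rewrite ⇒false rF (¬Edge-across (≰⇒> x≰1+i) (≰⇒> j≰x) (Spliced.at F))
        | ⇒false rG (¬Edge-across (≰⇒> x≰1+i) (≰⇒> j≰x) (Spliced.at G))
        | ⇒false r (¬Edge-across (≰⇒> x≰1+i) (≰⇒> j≰x) wx)
        | ⇒false r′ (¬Edge-across (≰⇒> x≰1+i) (≰⇒> j≰x) w′x) = refl

-- s below x and s′ from x on, with s′ negated if necessary so that x becomes a switch.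
splice : ℕ → (ℕ → Bool) → (ℕ → Bool) → ℕ → Bool
splice x s s′ k = if k <ᵇ x then s k else (s′ k xor (s′ x xor not (s (pred x))))

splice-Spliced : ∀ {n x} s s′ → 2 < x → x < n → Spliced x (switches n s) (switches n s′) (switches n (splice x s s′))
splice-Spliced {n} {x} s s′ 2<x x<n = record { below = below ; above = above ; at = at }
  where
    flipped = s′ x xor not (s (pred x))

    splice-below : ∀ {k} → k < x → splice x s s′ k ≡ s k
    splice-below k<x rewrite <ᵇ-true k<x = refl

    splice-above : ∀ {k} → ¬ k < x → splice x s s′ k ≡ (s′ k xor flipped)
    splice-above k≮x rewrite <ᵇ-false k≮x = refl

    same-switch : ∀ u v k → (u (pred k) xor u k) ≡ (v (pred k) xor v k) → switches n u k ≡ switches n v k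
    same-switch u v k = cong λ d → (2 <ᵇ k) ∧ (k <ᵇ n) ∧ d

    below : ∀ k → k < x → switches n (splice x s s′) k ≡ switches n s k
    below k k<x = same-switch (splice x s s′) s k (cong₂ _xor_ (splice-below (≤-<-trans pred[n]≤n k<x)) (splice-below k<x))

    above : ∀ k → x < k → switches n (splice x s s′) k ≡ switches n s′ k
    above (suc k) x<1+k = same-switch (splice x s s′) s′ (suc k)
      (trans (cong₂ _xor_ (splice-above (≤⇒≯ (≤-pred x<1+k))) (splice-above (<⇒≱ x<1+k ∘ <⇒≤)))
             (xor-cancelʳ (s′ k) (s′ (suc k)) flipped))

    at : switches n (splice x s s′) x ≡ true
    at = ⇒switch (splice x s s′) 2<x x<n λ same →
      not-¬ refl (trans (sym (splice-below (pred< 2<x)))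
                        (trans same (trans (splice-above (<-irrefl refl)) (xor-involutiveˡ (s′ x) _))))

crossing⇒¬Adjacent : ∀ {n t t′} → IsPyramidalTour n t → IsPyramidalTour n t′ →
                     Crossing (tourSwitches n t) (tourSwitches n t′) → ¬ Adjacent n t t′
crossing⇒¬Adjacent {n} {t} {t′} P P′ (x , p , q , p<x , x<q , wx , w′x , p-differs , q-differs) (_ , c , same-value , maximal) =
  ℚ.<-irrefl exchanged (ℚ.+-mono-< (maximal F PF F≉t F≉t′) (subst (eval n c G ℚ.<_) same-value (maximal G PG G≉t G≉t′)))
  where
    2<x = proj₁ (tourSwitch⇒ {n} {t} wx)
    x<n = proj₂ (tourSwitch⇒ {n} {t} wx)
    2≤n = ≤-trans (n≤1+n 2) (<-trans 2<x x<n)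

    F G : List ℕ
    F = tourOfSides n (splice x (sideOf P) (sideOf P′))
    G = tourOfSides n (splice x (sideOf P′) (sideOf P))
    PF = tourOfSides-pyramidal _ 2≤n
    PG = tourOfSides-pyramidal _ 2≤n

    F-spliced : Spliced x (tourSwitches n t) (tourSwitches n t′) (tourSwitches n F)
    F-spliced = Spliced-resp (sym ∘ tourSwitches≗switches P) (sym ∘ tourSwitches≗switches P′)
                             (sym ∘ tourSwitches-tourOfSides _ 2≤n) (splice-Spliced (sideOf P) (sideOf P′) 2<x x<n)

    G-spliced : Spliced x (tourSwitches n t′) (tourSwitches n t) (tourSwitches n G)
    G-spliced = Spliced-resp (sym ∘ tourSwitches≗switches P′) (sym ∘ tourSwitches≗switches P)
                             (sym ∘ tourSwitches-tourOfSides _ 2≤n) (splice-Spliced (sideOf P′) (sideOf P) 2<x x<n)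

    F≉t : ¬ SameVec n F t
    F≉t same = q-differs (trans (sym (SameVec⇒sameSwitches {n} F t same q)) (Spliced.above F-spliced q x<q))
    F≉t′ : ¬ SameVec n F t′
    F≉t′ same = p-differs (trans (sym (Spliced.below F-spliced p p<x)) (SameVec⇒sameSwitches {n} F t′ same p))
    G≉t : ¬ SameVec n G t
    G≉t same = p-differs (trans (sym (SameVec⇒sameSwitches {n} G t same p)) (Spliced.below G-spliced p p<x))
    G≉t′ : ¬ SameVec n G t′
    G≉t′ same = q-differs (trans (sym (Spliced.above G-spliced q x<q)) (SameVec⇒sameSwitches {n} G t′ same q))

    exchanged : eval n c F ℚ.+ eval n c G ≡ eval n c t ℚ.+ eval n c t′
    exchanged = evalOn-exchange (edgesK n) c F G t t′ λ where
      (i , j) e∈ → let 1≤i , i<j , j≤n = ∈-edgesK⁻ e∈ in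
        exchange i<j (charVec-reflects-tourEdge P 1≤i i<j j≤n) (charVec-reflects-tourEdge P′ 1≤i i<j j≤n)
                     (charVec-reflects-tourEdge PF 1≤i i<j j≤n) (charVec-reflects-tourEdge PG 1≤i i<j j≤n)
                     wx w′x F-spliced G-spliced

-- Families without crossings

-- Each member w is encoded by its last branch point k (w k holds, and fails for a member agreeing with w
-- below k) and its last switch before k; both are stored shifted by one, with 0 for none.
module NoCrossingFamily (n : ℕ) (ws : List (ℕ → Bool))
                        (no-crossing : ∀ {w w′} → w ∈ ws → w′ ∈ ws → ¬ Crossing w w′) where

  separates : (ℕ → Bool) → ℕ → (ℕ → Bool) → Bool
  separates w k v = does (Agree? w v k) ∧ not (v k)

  separates-reflects : ∀ w k v → Reflects (Agree w v k × v k ≡ false) (separates w k v)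
  separates-reflects w k v = proof (Agree? w v k) ×-reflects not-reflects-≡false (v k)

  branchPoint : (ℕ → Bool) → ℕ → Bool
  branchPoint w k = w k ∧ any (separates w k) ws

  branchPoint⇒ : ∀ {w k} → branchPoint w k ≡ true → w k ≡ true × ∃[ v ] (v ∈ ws × Agree w v k × v k ≡ false)
  branchPoint⇒ {w} {k} bp with w k in wk
  branchPoint⇒ () | false
  ... | true with any-true⇒ (separates w k) ws bp
  ... | v , v∈ , sep = refl , v , v∈ , true⇒ (separates-reflects w k v) sep

  ⇒branchPoint : ∀ {w v k} → v ∈ ws → w k ≡ true → Agree w v k → v k ≡ false → branchPoint w k ≡ true
  ⇒branchPoint {w} {v} {k} v∈ wk agree vk rewrite wk =
    ⇒any-true (separates w k) v∈ (⇒true (separates-reflects w k v) (agree , vk))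

  firstDifference-branches : ∀ {w w′ j} → w ∈ ws → w′ ∈ ws → w j ≢ w′ j → Agree w w′ j →
                             branchPoint w j ≡ true ⊎ branchPoint w′ j ≡ true
  firstDifference-branches {w} {w′} {j} w∈ w′∈ differ agree with w j Bool.≟ true
  ... | yes wj = inj₁ (⇒branchPoint w′∈ wj agree (¬-not (λ w′j → differ (trans wj (sym w′j)))))
  ... | no wj≢true =
    inj₂ (⇒branchPoint w∈ (¬-not (λ w′j → differ (trans wj (sym w′j)))) (λ k k<j → sym (agree k k<j)) wj)
    where wj = ¬-not wj≢true

  lastBranch lastBefore key : (ℕ → Bool) → ℕ
  lastBranch w = afterLast (branchPoint w) n
  lastBefore w = afterLast w (pred (lastBranch w))
  key w = lastBranch w * suc n + lastBefore w

  private
    lastBranch≤n : ∀ w → lastBranch w ≤ n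
    lastBranch≤n w = afterLast-≤ (branchPoint w) n

    lastBefore≤n : ∀ w → lastBefore w ≤ n
    lastBefore≤n w = ≤-trans (afterLast-≤ w _) (≤-trans pred[n]≤n (lastBranch≤n w))

  key< : ∀ w → key w < suc n * suc n
  key< w = begin-strict
    lastBranch w * suc n + lastBefore w ≤⟨ +-mono-≤ (*-monoˡ-≤ (suc n) (lastBranch≤n w)) (lastBefore≤n w) ⟩
    n * suc n + n                      <⟨ +-monoʳ-< (n * suc n) ≤-refl ⟩
    n * suc n + suc n                  ≡⟨ +-comm (n * suc n) (suc n) ⟩
    suc n * suc n                      ∎
    where open ≤-Reasoning

  module _ {w w′} (w∈ : w ∈ ws) (w′∈ : w′ ∈ ws) where

    agree-below-branch : ∀ {k} → w k ≡ true → branchPoint w′ k ≡ true → afterLast w k ≡ afterLast w′ k → Agree w w′ k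
    agree-below-branch {k} wk bp′ same-last with branchPoint⇒ bp′ | agree-or-firstDifference w w′ k
    ... | _ | inj₁ agree = agree
    ... | _ , v′ , v′∈ , agree′ , v′k | inj₂ (y , y<k , differ , _) with y <? afterLast w k
    ...   | no y≮ℓ = ⊥-elim (differ (trans (vanish w refl) (sym (vanish w′ same-last))))
      where
        vanish : ∀ u → afterLast w k ≡ afterLast u k → u y ≡ false
        vanish u ℓ≡ = afterLast-none u k y (subst (_≤ y) ℓ≡ (≮⇒≥ y≮ℓ)) y<k
    ...   | yes y<ℓ = ⊥-elim (crossing (afterLast w k) refl y<ℓ)
      where
        crossing : ∀ ℓ → afterLast w k ≡ ℓ → y < ℓ → ⊥
        crossing (suc z) ℓ≡1+z (s≤s y≤z) =
          no-crossing w∈ v′∈ (z , y , k , y<z , z<k , wz , trans (sym (agree′ z z<k)) w′z ,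
                              (λ e → differ (trans e (sym (agree′ y y<k)))) , (λ e → ≡true⇒≢false wk (trans e v′k)))
          where
            wz = afterLast-true w k ℓ≡1+z
            w′z = afterLast-true w′ k (trans (sym same-last) ℓ≡1+z)
            z<k = subst (_≤ k) ℓ≡1+z (afterLast-≤ w k)
            y<z = ≤∧≢⇒< y≤z (λ y≡z → differ (subst (λ i → w i ≡ w′ i) (sym y≡z) (trans wz (sym w′z))))

    module _ (same-key : key w ≡ key w′) where

      private
        same = *+-injective {b = lastBranch w} {lastBranch w′} (s≤s (lastBefore≤n w)) (s≤s (lastBefore≤n w′)) same-key

        b≡b′ : lastBranch w ≡ lastBranch w′
        b≡b′ = proj₁ same

      no-firstDifference : ∀ {j} → j < n → w j ≢ w′ j → Agree w w′ j → ⊥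
      no-firstDifference {j} j<n differ agree-below-j = j-vs-k (m≤n⇒m<n∨m≡n (≤-pred (subst (j <_) b≡1+k j<b)))
        where
          b = lastBranch w
          k = pred b

          j<b : j < b
          j<b with firstDifference-branches w∈ w′∈ differ agree-below-j
          ... | inj₁ bp = afterLast-> (branchPoint w) n bp j<n
          ... | inj₂ bp′ = subst (j <_) (sym b≡b′) (afterLast-> (branchPoint w′) n bp′ j<n)

          b≡1+k : b ≡ suc k
          b≡1+k = sym (suc-pred b {{>-nonZero (≤-<-trans z≤n j<b)}})

          bp : branchPoint w k ≡ true
          bp = afterLast-true (branchPoint w) n b≡1+k

          bp′ : branchPoint w′ k ≡ true
          bp′ = afterLast-true (branchPoint w′) n (trans (sym b≡b′) b≡1+k)

          agree-below-k : Agree w w′ k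
          agree-below-k = agree-below-branch (proj₁ (branchPoint⇒ bp)) bp′
                            (trans (proj₂ same) (cong (λ c → afterLast w′ (pred c)) (sym b≡b′)))

          j-vs-k : j < k ⊎ j ≡ k → ⊥
          j-vs-k (inj₁ j<k) = differ (agree-below-k j j<k)
          j-vs-k (inj₂ j≡k) = differ (subst (λ i → w i ≡ w′ i) (sym j≡k)
                                            (trans (proj₁ (branchPoint⇒ bp)) (sym (proj₁ (branchPoint⇒ bp′)))))

    key-injective : ¬ Agree w w′ n → key w ≢ key w′
    key-injective w≉w′ same-key with agree-or-firstDifference w w′ n
    ... | inj₁ agree = w≉w′ agree
    ... | inj₂ (j , j<n , differ , agree-below-j) = no-firstDifference same-key j<n differ agree-below-j

  family-bound : AllPairs (λ w w′ → ¬ Agree w w′ n) ws → length ws ≤ suc n * suc n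
  family-bound distinct = subst (_≤ suc n * suc n) (length-map key ws)
    (length-distinct-bounded (suc n * suc n) (map key ws)
      (AllPairs.map⁺ (AllPairs-map-∈ key-injective distinct)) (AllP.map⁺ (All.tabulate λ {w} _ → key< w)))

clique-bound : ∀ n ts → All (IsPyramidalTour n) ts → AllPairs (Adjacent n) ts → length ts ≤ suc n * suc n
clique-bound n ts pyramidal adjacent =
  subst (_≤ suc n * suc n) (length-map (tourSwitches n) ts)
        (NoCrossingFamily.family-bound n (map (tourSwitches n) ts) no-crossing (AllPairs.map⁺ (AllPairs-map-∈ distinct adjacent)))
  where
    no-crossing : ∀ {w w′} → w ∈ map (tourSwitches n) ts → w′ ∈ map (tourSwitches n) ts → ¬ Crossing w w′
    no-crossing w∈ w′∈ crossing with ∈-map⁻ (tourSwitches n) w∈ | ∈-map⁻ (tourSwitches n) w′∈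
    ... | t , t∈ , refl | t′ , t′∈ , refl with AllPairs-∈-cases adjacent t∈ t′∈
    ...   | inj₁ refl = Crossing-irrefl crossing
    ...   | inj₂ (inj₁ t~t′) = crossing⇒¬Adjacent (All.lookup pyramidal t∈) (All.lookup pyramidal t′∈) crossing t~t′
    ...   | inj₂ (inj₂ t′~t) =
      crossing⇒¬Adjacent (All.lookup pyramidal t′∈) (All.lookup pyramidal t∈) (Crossing-sym crossing) t′~t

    distinct : ∀ {t t′} → t ∈ ts → t′ ∈ ts → Adjacent n t t′ → ¬ Agree (tourSwitches n t) (tourSwitches n t′) n
    distinct {t} {t′} t∈ t′∈ (t≉t′ , _) agree =
      t≉t′ (sameSwitches⇒SameVec (All.lookup pyramidal t∈) (All.lookup pyramidal t′∈) same)
      where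
        same : ∀ k → tourSwitches n t k ≡ tourSwitches n t′ k
        same k with k <? n
        ... | yes k<n = agree k k<n
        ... | no k≮n =
          trans (tourSwitches-outside n t (inj₂ (≮⇒≥ k≮n))) (sym (tourSwitches-outside n t′ (inj₂ (≮⇒≥ k≮n))))

-- Two-switch tours

record TwoSwitch (n m : ℕ) (w : ℕ → Bool) : Set where
  field
    a b : ℕ
    3≤a : 3 ≤ a
    a<m : a < m
    m≤b : m ≤ b
    b<n : b < n
    only : ∀ k → w k ≡ true → k ≡ a ⊎ k ≡ b
    at-a : w a ≡ true
    at-b : w b ≡ true

  a<b : a < b
  a<b = <-≤-trans a<m m≤b

  first-edge : ∀ {d} → 3 ≤ d → Edge n w 1 d → d ≡ a
  first-edge 3≤d (inj₁ (refl , _)) = contradiction 3≤d (<-irrefl refl)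
  first-edge {d} 3≤d (inj₂ (_ , _ , last , none)) with <-cmp a d
  ... | tri< a<d _ _ = contradiction (none a 3≤a a<d) (≡true⇒≢false at-a)
  ... | tri≈ _ a≡d _ = sym a≡d
  ... | tri> _ _ d<a with last
  ...   | inj₁ refl = contradiction (<-trans d<a (<-trans a<b b<n)) (<-irrefl refl)
  ...   | inj₂ wd with only d wd
  ...     | inj₁ d≡a = d≡a
  ...     | inj₂ refl = contradiction (<-trans d<a a<b) (<-irrefl refl)

  middle-edge : ∀ {d d′} → 3 ≤ d → d < m → d < d′ → Edge n w (pred d) d′ → d ≡ a × d′ ≡ b
  middle-edge {suc d} 3≤d d<m d<d′ (inj₁ (refl , _)) = contradiction d<d′ (<-irrefl refl)
  middle-edge {suc d} {d′} 3≤d d<m d<d′ (inj₂ (_ , first , last , none)) = d≡a , last⇒ last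
    where
      first⇒ : d ≡ 1 ⊎ w (suc d) ≡ true → suc d ≡ a
      first⇒ (inj₁ d≡1) = contradiction (subst (λ i → 3 ≤ suc i) d≡1 3≤d) λ { (s≤s (s≤s ())) }
      first⇒ (inj₂ wd) with only (suc d) wd
      ... | inj₁ d≡a = d≡a
      ... | inj₂ d≡b = contradiction m≤b (<⇒≱ (subst (_< m) d≡b d<m))

      d≡a = first⇒ first

      last⇒ : d′ ≡ n ⊎ w d′ ≡ true → d′ ≡ b
      last⇒ l with <-cmp b d′
      ... | tri< b<d′ _ _ = contradiction (none b (subst (_< b) (sym d≡a) a<b) b<d′) (≡true⇒≢false at-b)
      ... | tri≈ _ b≡d′ _ = sym b≡d′
      last⇒ (inj₁ d′≡n) | tri> _ _ d′<b = contradiction (subst (_< n) d′≡n (<-trans d′<b b<n)) (<-irrefl refl)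
      last⇒ (inj₂ wd′) | tri> _ _ d′<b with only d′ wd′
      ... | inj₁ d′≡a = contradiction (subst (suc d <_) d′≡a d<d′) (<-irrefl d≡a)
      ... | inj₂ d′≡b = d′≡b

  last-edge : ∀ {d d′} → 3 ≤ d → m ≤ d → d < d′ → d′ ≤ n → Edge n w (pred d) d′ → d′ ≡ n
  last-edge {suc d} 3≤d m≤d d<d′ d′≤n (inj₁ (refl , _)) = contradiction d<d′ (<-irrefl refl)
  last-edge {suc d} 3≤d m≤d d<d′ d′≤n (inj₂ (_ , inj₁ refl , _)) = contradiction 3≤d λ { (s≤s (s≤s ())) }
  last-edge {suc d} {d′} 3≤d m≤d d<d′ d′≤n (inj₂ (_ , inj₂ wd , last , _)) with only (suc d) wd | last
  ... | inj₁ d≡a | _ = contradiction (subst (m ≤_) d≡a m≤d) (<⇒≱ a<m)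
  ... | inj₂ _ | inj₁ d′≡n = d′≡n
  ... | inj₂ d≡b | inj₂ wd′ with only d′ wd′
  ...   | inj₁ refl = contradiction (subst (_< d′) d≡b d<d′) (<-asym a<b)
  ...   | inj₂ refl = contradiction (subst (_< d′) d≡b d<d′) (<-irrefl refl)

  switches-determined : ∀ {u} → (∀ k → k ≤ 2 ⊎ n ≤ k → u k ≡ false) → None u 3 a → u a ≡ true →
                        None u (suc a) b → u b ≡ true → None u (suc b) n → ∀ k → u k ≡ w k
  switches-determined {u} outside none-a ua none-b ub none-n k with k ≟ a | k ≟ b
  ... | yes refl | _ = trans ua (sym at-a)
  ... | no _ | yes refl = trans ub (sym at-b)
  ... | no k≢a | no k≢b = trans u-false (sym w-false)
    where
      w-false : w k ≡ false
      w-false with w k Bool.≟ true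
      ... | yes wk = ⊥-elim (Sum.[ k≢a , k≢b ] (only k wk))
      ... | no wk≢true = ¬-not wk≢true

      u-false : u k ≡ false
      u-false with k <? 3
      ... | yes k<3 = outside k (inj₁ (≤-pred k<3))
      ... | no k≮3 with k <? a
      ...   | yes k<a = none-a k (≮⇒≥ k≮3) k<a
      ...   | no k≮a with k <? b
      ...     | yes k<b = none-b k (≤∧≢⇒< (≮⇒≥ k≮a) (k≢a ∘ sym)) k<b
      ...     | no k≮b with k <? n
      ...       | yes k<n = none-n k (≤∧≢⇒< (≮⇒≥ k≮b) (k≢b ∘ sym)) k<n
      ...       | no k≮n = outside k (inj₂ (≮⇒≥ k≮n))

TwoSwitch-unique : ∀ {n m w w′} (X : TwoSwitch n m w) (X′ : TwoSwitch n m w′) → (∀ k → w k ≡ w′ k) →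
                   TwoSwitch.a X ≡ TwoSwitch.a X′ × TwoSwitch.b X ≡ TwoSwitch.b X′
TwoSwitch-unique X X′ w≗w′ = first (X′.only X.a (trans (sym (w≗w′ X.a)) X.at-a)) ,
                              second (X′.only X.b (trans (sym (w≗w′ X.b)) X.at-b))
  where
    module X = TwoSwitch X
    module X′ = TwoSwitch X′

    first : X.a ≡ X′.a ⊎ X.a ≡ X′.b → X.a ≡ X′.a
    first (inj₁ a≡a′) = a≡a′
    first (inj₂ a≡b′) = contradiction (subst (_ ≤_) (sym a≡b′) X′.m≤b) (<⇒≱ X.a<m)

    second : X.b ≡ X′.a ⊎ X.b ≡ X′.b → X.b ≡ X′.b
    second (inj₁ b≡a′) = contradiction (subst (_ ≤_) b≡a′ X.m≤b) (<⇒≱ X′.a<m)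
    second (inj₂ b≡b′) = b≡b′

-- Follow the long edges of u from vertex 1: each one that is also an edge of w or of w′ determines the next
-- switch of u.
module Walk {n m : ℕ} {u w w′ : ℕ → Bool} (X : TwoSwitch n m w) (X′ : TwoSwitch n m w′)
            (u-outside : ∀ k → k ≤ 2 ⊎ n ≤ k → u k ≡ false) where

  Escape Outcome : Set
  Escape = ∃[ i ] ∃[ j ] (1 ≤ i × i < j × j ≤ n × Edge n u i j × ¬ Edge n w i j × ¬ Edge n w′ i j)
  Outcome = Escape ⊎ (∀ k → u k ≡ w k) ⊎ (∀ k → u k ≡ w′ k)

  private
    covered-or-escape : ∀ {i j} → 1 ≤ i → i < j → j ≤ n → Edge n u i j → Edge n w i j ⊎ Edge n w′ i j ⊎ Escape
    covered-or-escape {i} {j} 1≤i i<j j≤n e with Edge? n w i j | Edge? n w′ i j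
    ... | yes inW | _ = inj₁ inW
    ... | no _ | yes inW′ = inj₂ (inj₁ inW′)
    ... | no ¬inW | no ¬inW′ = inj₂ (inj₂ (_ , _ , 1≤i , i<j , j≤n , e , ¬inW , ¬inW′))

    switch-edge : ∀ {d d′} → 3 ≤ d → d < d′ → u d ≡ true → d′ ≡ n ⊎ u d′ ≡ true → None u (suc d) d′ →
                  Edge n u (pred d) d′
    switch-edge {suc d} _ d<d′ ud hit none = inj₂ ((λ d′≡1+d → <-irrefl (sym d′≡1+d) d<d′) , inj₂ ud , hit , none)

    1≤pred : ∀ {d} → 3 ≤ d → 1 ≤ pred d
    1≤pred (s≤s (s≤s (s≤s _))) = s≤s z≤n

    hit-below-n : ∀ {d} → d < n → d ≡ n ⊎ u d ≡ true → u d ≡ true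
    hit-below-n d<n (inj₁ refl) = contradiction d<n (<-irrefl refl)
    hit-below-n _ (inj₂ ud) = ud

    after-last-switch : ∀ {v} (Y : TwoSwitch n m v) {d d′} → d ≡ TwoSwitch.a Y → d′ ≡ TwoSwitch.b Y →
                        None u 3 d → u d ≡ true → None u (suc d) d′ → d′ ≡ n ⊎ u d′ ≡ true →
                        Escape ⊎ (∀ k → u k ≡ v k)
    after-last-switch Y refl refl none-a ua none-b hit-b with nextTrue u (suc b) n b<n
      where open TwoSwitch Y
    ... | record { at = d ; lo≤at = b<d ; at≤hi = d≤n ; hit = hit ; none-before = none } =
      finish (covered-or-escape (1≤pred 3≤b) (≤-<-trans pred[n]≤n b<d) d≤n (switch-edge 3≤b b<d ub hit none))
      where
        open TwoSwitch Y
        3≤b = ≤-trans 3≤a (<⇒≤ a<b)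
        ub = hit-below-n b<n hit-b

        determined : d ≡ n → ∀ k → u k ≡ _
        determined refl = switches-determined u-outside none-a ua none-b ub none

        finish : Edge n w (pred b) d ⊎ Edge n w′ (pred b) d ⊎ Escape → Escape ⊎ (∀ k → u k ≡ _)
        finish (inj₁ inW) = inj₂ (determined (TwoSwitch.last-edge X 3≤b m≤b b<d d≤n inW))
        finish (inj₂ (inj₁ inW′)) = inj₂ (determined (TwoSwitch.last-edge X′ 3≤b m≤b b<d d≤n inW′))
        finish (inj₂ (inj₂ escape)) = inj₁ escape

    after-first-switch : ∀ {d} → 3 ≤ d → d < m → u d ≡ true → None u 3 d →
                         Outcome
    after-first-switch {d} 3≤d d<m ud none-d with nextTrue u (suc d) n (<-trans d<m (≤-<-trans (TwoSwitch.m≤b X) (TwoSwitch.b<n X)))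
    ... | record { at = d′ ; lo≤at = d<d′ ; at≤hi = d′≤n ; hit = hit ; none-before = none } =
      finish (covered-or-escape (1≤pred 3≤d) (≤-<-trans pred[n]≤n d<d′) d′≤n (switch-edge 3≤d d<d′ ud hit none))
      where
        finish : Edge n w (pred d) d′ ⊎ Edge n w′ (pred d) d′ ⊎ Escape → Outcome
        finish (inj₁ inW) with TwoSwitch.middle-edge X 3≤d d<m d<d′ inW
        ... | d≡a , d′≡b = Sum.map₂ inj₁ (after-last-switch X d≡a d′≡b none-d ud none hit)
        finish (inj₂ (inj₁ inW′)) with TwoSwitch.middle-edge X′ 3≤d d<m d<d′ inW′
        ... | d≡a , d′≡b = Sum.map₂ inj₂ (after-last-switch X′ d≡a d′≡b none-d ud none hit)
        finish (inj₂ (inj₂ escape)) = inj₁ escape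

  walk : Outcome
  walk with nextTrue u 3 n (≤-trans (TwoSwitch.3≤a X) (<⇒≤ (<-trans (TwoSwitch.a<b X) (TwoSwitch.b<n X))))
  ... | record { at = d ; lo≤at = 3≤d ; at≤hi = d≤n ; hit = hit ; none-before = none } =
    finish (covered-or-escape ≤-refl (<-≤-trans (s≤s (s≤s z≤n)) 3≤d) d≤n (inj₂ (d≢2 , inj₁ refl , hit , none)))
    where
      d≢2 : d ≢ 2
      d≢2 d≡2 = contradiction (subst (3 ≤_) d≡2 3≤d) λ { (s≤s (s≤s ())) }

      start : ∀ {v} (Y : TwoSwitch n m v) → d ≡ TwoSwitch.a Y → Outcome
      start Y d≡a = after-first-switch 3≤d (subst (_< m) (sym d≡a) (TwoSwitch.a<m Y))
                      (hit-below-n (subst (_< n) (sym d≡a) (<-trans (TwoSwitch.a<b Y) (TwoSwitch.b<n Y))) hit) none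

      finish : Edge n w 1 d ⊎ Edge n w′ 1 d ⊎ Escape → Outcome
      finish (inj₁ inW) = start X (TwoSwitch.first-edge X 3≤d inW)
      finish (inj₂ (inj₁ inW′)) = start X′ (TwoSwitch.first-edge X′ 3≤d inW′)
      finish (inj₂ (inj₂ escape)) = inj₁ escape

Straddles : ℕ → ℕ → ℕ × ℕ → Set
Straddles n m (a , b) = 3 ≤ a × a < m × m ≤ b × b < n

twoSwitchSides : ℕ × ℕ → ℕ → Bool
twoSwitchSides (a , b) k = (k <ᵇ a) ∨ (b ≤ᵇ k)

twoSwitchSides-reflects : ∀ a b k → Reflects (k < a ⊎ b ≤ k) (twoSwitchSides (a , b) k)
twoSwitchSides-reflects a b k = <ᵇ-reflects-< k a ⊎-reflects ≤ᵇ-reflects-≤ b k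

twoSwitchTour : ℕ → ℕ × ℕ → List ℕ
twoSwitchTour n ab = tourOfSides n (twoSwitchSides ab)

twoSwitchTour-pyramidal : ∀ {n m ab} → Straddles n m ab → IsPyramidalTour n (twoSwitchTour n ab)
twoSwitchTour-pyramidal (3≤a , a<m , m≤b , b<n) =
  tourOfSides-pyramidal _ (≤-trans (n≤1+n 2) (≤-trans 3≤a (<⇒≤ (<-trans (<-≤-trans a<m m≤b) b<n))))

twoSwitchTour-TwoSwitch : ∀ {n m ab} → Straddles n m ab → TwoSwitch n m (tourSwitches n (twoSwitchTour n ab))
twoSwitchTour-TwoSwitch {n} {m} {a , b} (3≤a , a<m , m≤b , b<n) = record
  { a = a ; b = b ; 3≤a = 3≤a ; a<m = a<m ; m≤b = m≤b ; b<n = b<n ; only = only ; at-a = at-a ; at-b = at-b }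
  where
    a<b = <-≤-trans a<m m≤b
    r = twoSwitchSides-reflects a b
    switches≡ = tourSwitches-tourOfSides (twoSwitchSides (a , b)) (≤-trans (n≤1+n 2) (≤-trans 3≤a (<⇒≤ (<-trans a<b b<n))))

    constant : ∀ k → suc k ≢ a → suc k ≢ b → twoSwitchSides (a , b) k ≡ twoSwitchSides (a , b) (suc k)
    constant k ≢a ≢b = det (r k) (Reflects-map (Sum.map (<-trans (n<1+n k)) (λ b≤1+k → ≤-pred (≤∧≢⇒< b≤1+k (≢b ∘ sym))))
                                               (Sum.map (λ k<a → ≤∧≢⇒< k<a ≢a) m≤n⇒m≤1+n) (r (suc k)))

    only : ∀ k → tourSwitches n (twoSwitchTour n (a , b)) k ≡ true → k ≡ a ⊎ k ≡ b
    only k sw with k ≟ a | k ≟ b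
    ... | yes k≡a | _ = inj₁ k≡a
    ... | no _ | yes k≡b = inj₂ k≡b
    ... | no k≢a | no k≢b with switch⇒ n (twoSwitchSides (a , b)) {k} (trans (sym (switches≡ k)) sw)
    only (suc k) sw | no k≢a | no k≢b | _ , _ , differ = contradiction (constant k k≢a k≢b) differ

    at-a : tourSwitches n (twoSwitchTour n (a , b)) a ≡ true
    at-a = trans (switches≡ a) (⇒switch (twoSwitchSides (a , b)) 3≤a (<-trans a<b b<n) λ e →
      ≡true⇒≢false (⇒true (r (pred a)) (inj₁ (pred< 3≤a))) (trans e (⇒false (r a) Sum.[ <-irrefl refl , <⇒≱ a<b ])))

    at-b : tourSwitches n (twoSwitchTour n (a , b)) b ≡ true
    at-b = trans (switches≡ b) (⇒switch (twoSwitchSides (a , b)) (<-≤-trans 3≤a (<⇒≤ a<b)) b<n λ e →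
      ≡true⇒≢false (⇒true (r b) (inj₂ ≤-refl))
        (trans (sym e) (⇒false (r (pred b)) Sum.[ ≤⇒≯ (pred-mono-≤ a<b) , <⇒≱ (pred< a<b) ])))

twoSwitchTours-adjacent : ∀ {n m ab ab′} → Straddles n m ab → Straddles n m ab′ → ab ≢ ab′ →
                          Adjacent n (twoSwitchTour n ab) (twoSwitchTour n ab′)
twoSwitchTours-adjacent {n} {m} {ab} {ab′} straddles straddles′ ab≢ab′ = S≉S′ , c , trans value-S (sym value-S′) , maximal
  where
    open import Data.Rational using (0ℚ; 1ℚ; -_)
    import Data.Integer as ℤ

    -1<0 : - 1ℚ ℚ.< 0ℚ
    -1<0 = ℚ.*<* ℤ.-<+

    S = twoSwitchTour n ab
    S′ = twoSwitchTour n ab′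
    P = twoSwitchTour-pyramidal straddles
    P′ = twoSwitchTour-pyramidal straddles′
    X = twoSwitchTour-TwoSwitch straddles
    X′ = twoSwitchTour-TwoSwitch straddles′

    S≉S′ : ¬ SameVec n S S′
    S≉S′ same with TwoSwitch-unique X X′ (SameVec⇒sameSwitches {n} S S′ same)
    ... | a≡a′ , b≡b′ = ab≢ab′ (cong₂ _,_ a≡a′ b≡b′)

    c : ℕ × ℕ → ℚ.ℚ
    c e = if charVec S e ∨ charVec S′ e then 0ℚ else - 1ℚ

    value-S : eval n c S ≡ 0ℚ
    value-S = evalOn-zero (edgesK n) c S λ e _ Se → cong (if_then 0ℚ else - 1ℚ) (cong (_∨ charVec S′ e) Se)

    value-S′ : eval n c S′ ≡ 0ℚ
    value-S′ = evalOn-zero (edgesK n) c S′ λ e _ S′e →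
      cong (if_then 0ℚ else - 1ℚ) (trans (cong (charVec S e ∨_) S′e) (∨-zeroʳ _))

    c≤0 : ∀ e → c e ℚ.≤ 0ℚ
    c≤0 e with charVec S e ∨ charVec S′ e
    ... | true = ℚ.≤-refl
    ... | false = ℚ.<⇒≤ -1<0

    maximal : ∀ u → IsPyramidalTour n u → ¬ SameVec n u S → ¬ SameVec n u S′ → eval n c u ℚ.< eval n c S
    maximal u Pu u≉S u≉S′ with Walk.walk X X′ (λ k → tourSwitches-outside n u)
    ... | inj₂ (inj₁ same) = contradiction (sameSwitches⇒SameVec Pu P same) u≉S
    ... | inj₂ (inj₂ same) = contradiction (sameSwitches⇒SameVec Pu P′ same) u≉S′
    ... | inj₁ (i , j , 1≤i , i<j , j≤n , in-u , ¬in-S , ¬in-S′) =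
      subst (eval n c u ℚ.<_) (sym value-S)
        (evalOn<0 (edgesK n) c u c≤0 (∈-edgesK⁺ 1≤i i<j j≤n) (⇒true (charVec-reflects-tourEdge Pu 1≤i i<j j≤n) in-u) c<0)
      where
        c<0 : c (i , j) ℚ.< 0ℚ
        c<0 rewrite ⇒false (charVec-reflects-tourEdge P 1≤i i<j j≤n) ¬in-S
                  | ⇒false (charVec-reflects-tourEdge P′ 1≤i i<j j≤n) ¬in-S′ = -1<0

large-clique : ∀ n h → 3 + h + h ≤ n → ∃[ ts ] (All (IsPyramidalTour n) ts × AllPairs (Adjacent n) ts × length ts ≡ h * h)
large-clique n h 3+2h≤n = map (twoSwitchTour n) pairs , pyramidal , adjacent , size
  where
    m = 3 + h
    pairs = cartesianProduct (applyUpTo (3 +_) h) (applyUpTo (m +_) h)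

    straddles : ∀ {ab} → ab ∈ pairs → Straddles n m ab
    straddles ab∈ with ∈-cartesianProduct⁻ (applyUpTo (3 +_) h) (applyUpTo (m +_) h) ab∈
    ... | a∈ , b∈ with ∈-applyUpTo⁻ (3 +_) a∈ | ∈-applyUpTo⁻ (m +_) b∈
    ... | i , i<h , refl | j , j<h , refl =
      m≤m+n 3 i , +-monoʳ-< 3 i<h , m≤m+n m j , <-≤-trans (+-monoʳ-< m j<h) 3+2h≤n

    distinct-from : ∀ k {i j} → i < j → j < h → k + i ≢ k + j
    distinct-from k i<j _ = <⇒≢ (+-monoʳ-< k i<j)

    pyramidal : All (IsPyramidalTour n) (map (twoSwitchTour n) pairs)
    pyramidal = AllP.map⁺ (All.tabulate (twoSwitchTour-pyramidal ∘ straddles))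

    adjacent : AllPairs (Adjacent n) (map (twoSwitchTour n) pairs)
    adjacent = AllPairs.map⁺ (AllPairs-map-∈ (λ ab∈ ab′∈ → twoSwitchTours-adjacent (straddles ab∈) (straddles ab′∈))
                 (Unique.cartesianProduct⁺ (Unique.applyUpTo⁺₁ (3 +_) h (distinct-from 3))
                                           (Unique.applyUpTo⁺₁ (m +_) h (distinct-from m))))

    size : length (map (twoSwitchTour n) pairs) ≡ h * h
    size = trans (length-map _ pairs)
                 (trans (length-cartesianProduct (applyUpTo (3 +_) h) (applyUpTo (m +_) h))
                        (cong₂ _*_ (length-applyUpTo (3 +_) h) (length-applyUpTo (m +_) h)))

clique-size : ∀ n → 7 ≤ n → ∃[ h ] (3 + h + h ≤ n × n ≤ 4 * h)
clique-size n 7≤n = h , 3+2h≤n , n≤4h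
  where
    open import Data.Nat.DivMod using (_/_; _%_; m≡m%n+[m/n]*n; m%n<n)
    open ≤-Reasoning

    rest = n ∸ 3
    h = rest / 2
    r = rest % 2

    rest≡ : rest ≡ r + h * 2
    rest≡ = m≡m%n+[m/n]*n rest 2

    n≡ : n ≡ 3 + (r + h * 2)
    n≡ = trans (sym (m+[n∸m]≡n (≤-trans (s≤s (s≤s (s≤s z≤n))) 7≤n))) (cong (3 +_) rest≡)

    r≤1 : r ≤ 1
    r≤1 = ≤-pred (m%n<n rest 2)

    3+2h≤n : 3 + h + h ≤ n
    3+2h≤n = begin
      3 + h + h              ≡⟨ +-assoc 3 h h ⟩
      3 + (h + h)            ≤⟨ +-monoʳ-≤ 3 (m≤n+m (h + h) r) ⟩
      3 + (r + (h + h))      ≡⟨ cong (λ x → 3 + (r + x)) (trans (*-comm h 2) (cong (h +_) (+-identityʳ h))) ⟨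
      3 + (r + h * 2)        ≡⟨ n≡ ⟨
      n                      ∎

    2≤h : 2 ≤ h
    2≤h with 2 ≤? h
    ... | yes 2≤h = 2≤h
    ... | no 2≰h = contradiction (begin
      4           ≤⟨ ∸-monoˡ-≤ 3 7≤n ⟩
      rest        ≡⟨ rest≡ ⟩
      r + h * 2   ≤⟨ +-mono-≤ r≤1 (*-monoˡ-≤ 2 (≤-pred (≰⇒> 2≰h))) ⟩
      3           ∎) λ { (s≤s (s≤s (s≤s ()))) }

    n≤4h : n ≤ 4 * h
    n≤4h = begin
      n                 ≡⟨ n≡ ⟩
      3 + (r + h * 2)   ≤⟨ +-monoʳ-≤ 3 (+-monoˡ-≤ (h * 2) r≤1) ⟩
      4 + h * 2         ≤⟨ +-monoˡ-≤ (h * 2) (*-monoˡ-≤ 2 2≤h) ⟩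
      h * 2 + h * 2     ≡⟨ *-distribˡ-+ h 2 2 ⟨
      h * 4             ≡⟨ *-comm h 4 ⟩
      4 * h             ∎

lower-bound : ∀ n → 7 ≤ n → ∃[ ts ] (All (IsPyramidalTour n) ts × AllPairs (Adjacent n) ts × n ^ 2 ≤ 16 * length ts)
lower-bound n 7≤n with clique-size n 7≤n
... | h , fits , n≤4h with large-clique n h fits
... | ts , pyramidal , adjacent , size =
  ts , pyramidal , adjacent , subst₂ _≤_ (sym (^2≡* n)) (cong (16 *_) (sym size)) (square-≤ 4 h n≤4h)

upper-bound : ∀ n → 1 ≤ n → ∀ ts → All (IsPyramidalTour n) ts → AllPairs (Adjacent n) ts → length ts ≤ 4 * n ^ 2
upper-bound n 1≤n ts pyramidal adjacent = begin
  length ts       ≤⟨ clique-bound n ts pyramidal adjacent ⟩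
  suc n * suc n   ≤⟨ square-≤ 2 n 1+n≤2n ⟩
  4 * (n * n)     ≡⟨ cong (4 *_) (^2≡* n) ⟨
  4 * n ^ 2       ∎
  where
    open ≤-Reasoning
    1+n≤2n : suc n ≤ 2 * n
    1+n≤2n = ≤-trans (≤-reflexive (+-comm 1 n)) (+-monoʳ-≤ n (≤-trans 1≤n (≤-reflexive (sym (+-identityʳ n)))))

theorem6 : ∃[ a ] ∃[ b ] ∃[ N ]
    ( 1 ≤ a × 1 ≤ b ×
      (∀ n → N ≤ n →
        ( ∃[ ts ] ( All (IsPyramidalTour n) ts
                  × AllPairs (Adjacent n) ts
                  × n ^ 2 ≤ a * length ts ) )
        × (∀ (ts : List (List ℕ)) → All (IsPyramidalTour n) ts
                  → AllPairs (Adjacent n) ts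
                  → length ts ≤ b * n ^ 2) ) )
theorem6 = 16 , 4 , 7 , s≤s z≤n , s≤s z≤n , λ n 7≤n →
  lower-bound n 7≤n , upper-bound n (≤-trans (s≤s z≤n) 7≤n)
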